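{- For any $n\geq 1$, $w\in\{+,-\}^n$ and nonnegative integers $i,j,k$ with $i+j+k=n$, we have \begin{align*} f^+_{w+,i,j,k}&=\sum_{j'=0}^{j-1} f^-_{w,i+j-1-j',j',k}+\sum_{k'=0}^{k-1} f^+_{w,k-1-k',i+j,k'},\\ f^-_{w+,i,j,k}&=\sum_{i'=0}^{i-1} f^+_{w,i',j,i+k-1-i'},\\ f^+_{w-,i,j,k}&=\sum_{i'=0}^{i-1} f^-_{w,i',i+j-1-i',k},\\ f^-_{w-,i,j,k}&=\sum_{k'=0}^{k-1} f^+_{w,i+k-1-k',j,k'}+\sum_{j'=0}^{j-1} f^-_{w,j-1-j',j',i+k}, \end{align*} where empty sums are $0$.
   Context: A total cyclic order on a finite set $X$ is a set $Z$ of triples of distinct elements of $X$ such that: $(x,y,z)\in Z\Rightarrow (y,z,x)\in Z$; $(x,y,z)\in Z\Rightarrow (z,y,x)\notin Z$; $(x,y,z)\in Z$ and $(x,z,u)\in Z\Rightarrow (x,y,u)\in Z$; and for any three distinct $x,y,z$, either $(x,y,z)\in Z$ or $(z,y,x)\in Z$. For $w=\epsilon_1\cdots\epsilon_{m-2}\in\{+,-\}^{m-2}$ ($m\geq3$), $\mathcal{P}_w$ is the set of total cyclic orders $Z$ on $[m]$ such that for every $1\leq i\leq m-2$, $(i,i+1,i+2)\in Z$ if $\epsilon_i=+$ and $(i+2,i+1,i)\in Z$ if $\epsilon_i=-$. $\mathcal{Q}^+_w$ (resp. $\mathcal{Q}^-_w$) is the set of $Z\in\mathcal{P}_w$ with $(m-1,m,1)\in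 Z$ (resp. $(1,m,m-1)\in Z$). The content of the arc from $a$ to $b$ is $c_Z(a,b)=\#\{x:(a,x,b)\in Z\}$, and the multi-content of distinct $y_1,\dots,y_p$ is $\tilde c_Z(y_1,\dots,y_p)=(c_Z(y_1,y_2),\dots,c_Z(y_{p-1},y_p),c_Z(y_p,y_1))$. For $w\in\{+,-\}^{m-2}$ and nonnegative $i,j,k$ with $i+j+k=m-3$, set $f^+_{w,i,j,k}=\#\{Z\in\mathcal{Q}^+_w:\tilde c_Z(m-1,m,1)=(i,j,k)\}$ and $f^-_{w,i,j,k}=\#\{Z\in\mathcal{Q}^-_w:\tilde c_Z(m,m-1,1)=(i,j,k)\}$. For a word $w$, $w+$ (resp. $w-$) denotes $w$ with the letter $+$ (resp. $-$) appended at the end. -}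

module Defs where

open import Data.Bool using (Bool; true; false; _∧_; _∨_; not; if_then_else_)
open import Data.Nat using (ℕ; zero; suc; _+_; _≡ᵇ_)
open import Data.Fin using (Fin; zero; suc; fromℕ; inject₁; _≟_)
open import Data.List using (List; []; _∷_; map; concatMap; foldr; length; filter; allFin)
open import Data.Vec using (Vec)
open import Relation.Nullary.Decidable using (⌊_⌋)
open import Function using (_∘_)

data Sign : Set where
  plus minus : Sign

_⇒ᵇ_ : Bool → Bool → Bool
a ⇒ᵇ b = not a ∨ b

-- Points 1,…,m of [m] are represented by Fin m (point p ↦ index p-1).
-- A set Z of triples on [m] is represented by its characteristic function.
Triples : ℕ → Set
Triples m = Fin m → Fin m → Fin m → Bool

allFuns : {A : Set} → List A → (n : ℕ) → List (Fin n → A)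
allFuns as zero = (λ ()) ∷ []
allFuns as (suc n) =
  concatMap (λ a → map (λ f → λ { zero → a ; (suc i) → f i }) (allFuns as n)) as

allTriples : (m : ℕ) → List (Triples m)
allTriples m = allFuns (allFuns (allFuns (true ∷ false ∷ []) m) m) m

∀ᵇ : {m : ℕ} → (Fin m → Bool) → Bool
∀ᵇ {m} p = foldr (λ x b → p x ∧ b) true (allFin m)

distinctᵇ : {m : ℕ} → Fin m → Fin m → Fin m → Bool
distinctᵇ x y z = not ⌊ x ≟ y ⌋ ∧ not ⌊ y ≟ z ⌋ ∧ not ⌊ x ≟ z ⌋

isTotalCyclicOrder : {m : ℕ} → Triples m → Bool
isTotalCyclicOrder Z =
  ∀ᵇ λ x → ∀ᵇ λ y → ∀ᵇ λ z →
       (Z x y z ⇒ᵇ distinctᵇ x y z)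
    ∧ (Z x y z ⇒ᵇ Z y z x)
    ∧ (Z x y z ⇒ᵇ not (Z z y x))
    ∧ (∀ᵇ λ u → (Z x y z ∧ Z x z u) ⇒ᵇ Z x y u)
    ∧ (distinctᵇ x y z ⇒ᵇ (Z x y z ∨ Z z y x))

-- Z ∈ 𝒫_w  for w ∈ {+,-}^n, m = n + 2.  Letter i (0-based) constrains the
-- points i+1, i+2, i+3 (indices i, i+1, i+2).
respectsWord : {n : ℕ} → Vec Sign n → Triples (suc (suc n)) → Bool
respectsWord {n} w Z = ∀ᵇ λ i → check (Data.Vec.lookup w i) i
  where
  check : Sign → Fin n → Bool
  check plus  i = Z (inject₁ (inject₁ i)) (suc (inject₁ i)) (suc (suc i))
  check minus i = Z (suc (suc i)) (suc (inject₁ i)) (inject₁ (inject₁ i))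

inP : {n : ℕ} → Vec Sign n → Triples (suc (suc n)) → Bool
inP w Z = isTotalCyclicOrder Z ∧ respectsWord w Z

pt-m-1 : (n : ℕ) → Fin (suc (suc n))
pt-m-1 n = inject₁ (fromℕ n)

pt-m : (n : ℕ) → Fin (suc (suc n))
pt-m n = fromℕ (suc n)

pt-1 : (n : ℕ) → Fin (suc (suc n))
pt-1 n = zero

inQ⁺ : {n : ℕ} → Vec Sign n → Triples (suc (suc n)) → Bool
inQ⁺ {n} w Z = inP w Z ∧ Z (pt-m-1 n) (pt-m n) (pt-1 n)

inQ⁻ : {n : ℕ} → Vec Sign n → Triples (suc (suc n)) → Bool
inQ⁻ {n} w Z = inP w Z ∧ Z (pt-1 n) (pt-m n) (pt-m-1 n)

content : {m : ℕ} → Triples m → Fin m → Fin m → ℕ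
content {m} Z a b = length (filter (λ x → Z a x b Data.Bool.≟ true) (allFin m))

mcEq : {m : ℕ} → Triples m → Fin m → Fin m → Fin m → ℕ → ℕ → ℕ → Bool
mcEq Z a b c i j k =
  (content Z a b ≡ᵇ i) ∧ (content Z b c ≡ᵇ j) ∧ (content Z c a ≡ᵇ k)

countWhere : {m : ℕ} → (Triples m → Bool) → ℕ
countWhere {m} p = length (filter (λ Z → p Z Data.Bool.≟ true) (allTriples m))

f⁺ : {n : ℕ} → Vec Sign n → ℕ → ℕ → ℕ → ℕ
f⁺ {n} w i j k = countWhere (λ Z → inQ⁺ w Z ∧ mcEq Z (pt-m-1 n) (pt-m n) (pt-1 n) i j k)

f⁻ : {n : ℕ} → Vec Sign n → ℕ → ℕ → ℕ → ℕ
f⁻ {n} w i j k = countWhere (λ Z → inQ⁻ w Z ∧ mcEq Z (pt-m n) (pt-m-1 n) (pt-1 n) i j k)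

sumBelow : ℕ → (ℕ → ℕ) → ℕ
sumBelow zero g = 0
sumBelow (suc b) g = sumBelow b g + g b

-- A total cyclic order on [m + 1] is the same as its restriction Z to [m] together with the
-- point a of [m] that m + 1 immediately follows. The last letter of w± asks that a lie on one
-- of the two arcs between m − 1 and m, and membership in Q± for [m + 1] confines a to an arc
-- between m and 1. Along such an arc the contents of the enlarged order at m, m + 1, 1 are
-- those of Z shifted by the position of a, and every position occurs exactly once. Summing
-- over a thus turns f±_{w±,i,j,k} into a single sum over positions of the numbers f±_{w,…},
-- the sign being decided by the orientation of (m − 1, m, 1) in Z; reindexing gives the
-- four recurrences.
module Submission where

open import Defs
open import Data.Nat using (ℕ; suc; _+_; _∸_; _≥_; s≤s; z≤n)
open import Data.Vec using (Vec; _∷ʳ_)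
open import Data.Product using (_×_; _,_)
open import Relation.Binary.PropositionalEquality using (_≡_)

module Booleans where

  open import Data.Bool using (true; false; _∧_; _∨_; not)
  open import Data.Bool.Properties using (⇔→≡)
  open import Data.Fin using (Fin; _≟_)
  open import Data.Nat using (ℕ)
  open import Data.Sum using (_⊎_; inj₁; inj₂)
  open import Function.Bundles using (mk⇔)
  open import Relation.Nullary using (¬_; yes; no; contradiction)
  open import Relation.Nullary.Decidable using (⌊_⌋)
  open import Relation.Binary.PropositionalEquality using (_≡_; refl; sym)
  open import Defs using (_⇒ᵇ_)

  ∧-elimˡ : ∀ a {b} → (a ∧ b) ≡ true → a ≡ true
  ∧-elimˡ true _ = refl

  ∧-elimʳ : ∀ a {b} → (a ∧ b) ≡ true → b ≡ true
  ∧-elimʳ true e = e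

  ∧-intro : ∀ {a b} → a ≡ true → b ≡ true → (a ∧ b) ≡ true
  ∧-intro refl refl = refl

  ∨-elim : ∀ {a b} → (a ∨ b) ≡ true → a ≡ true ⊎ b ≡ true
  ∨-elim {true} _ = inj₁ refl
  ∨-elim {false} e = inj₂ e

  ∨-introˡ : ∀ {a b} → a ≡ true → (a ∨ b) ≡ true
  ∨-introˡ refl = refl

  ∨-introʳ : ∀ {a b} → b ≡ true → (a ∨ b) ≡ true
  ∨-introʳ {true} _ = refl
  ∨-introʳ {false} e = e

  ⇒ᵇ-elim : ∀ a {b} → (a ⇒ᵇ b) ≡ true → a ≡ true → b ≡ true
  ⇒ᵇ-elim true e refl = e

  ⇒ᵇ-intro : ∀ a b → (a ≡ true → b ≡ true) → (a ⇒ᵇ b) ≡ true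
  ⇒ᵇ-intro true b f = f refl
  ⇒ᵇ-intro false b f = refl

  not-elim : ∀ {a} → not a ≡ true → a ≡ false
  not-elim {false} _ = refl

  not-intro : ∀ {a} → a ≡ false → not a ≡ true
  not-intro refl = refl

  ⇔⇒≡ : ∀ {a b} → (a ≡ true → b ≡ true) → (b ≡ true → a ≡ true) → a ≡ b
  ⇔⇒≡ f g = ⇔→≡ (mk⇔ f g)

  module _ {m : ℕ} {x y : Fin m} where

    ⌊≟⌋-true : x ≡ y → ⌊ x ≟ y ⌋ ≡ true
    ⌊≟⌋-true e with x ≟ y
    ... | yes _ = refl
    ... | no x≢y = contradiction e x≢y

    ⌊≟⌋-false : ¬ x ≡ y → ⌊ x ≟ y ⌋ ≡ false
    ⌊≟⌋-false x≢y with x ≟ y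
    ... | yes e = contradiction e x≢y
    ... | no _ = refl

    ⌊≟⌋-true⇒≡ : ⌊ x ≟ y ⌋ ≡ true → x ≡ y
    ⌊≟⌋-true⇒≡ e with x ≟ y
    ... | yes x≡y = x≡y

    ⌊≟⌋-false⇒≢ : ⌊ x ≟ y ⌋ ≡ false → ¬ x ≡ y
    ⌊≟⌋-false⇒≢ e with x ≟ y
    ... | no x≢y = x≢y

  ⌊≟⌋-sym : ∀ {m} (x y : Fin m) → ⌊ x ≟ y ⌋ ≡ ⌊ y ≟ x ⌋
  ⌊≟⌋-sym x y = ⇔⇒≡ (λ e → ⌊≟⌋-true (sym (⌊≟⌋-true⇒≡ e))) (λ e → ⌊≟⌋-true (sym (⌊≟⌋-true⇒≡ e)))

module Counting where

  open import Defs
  open Booleans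
  import Data.Nat.Properties
  open import Algebra.Properties.CommutativeSemigroup Data.Nat.Properties.+-commutativeSemigroup using (interchange)
  open import Data.Bool using (Bool; true; false; _∧_)
  open import Data.Bool.Properties using () renaming (_≟_ to _≟B_)
  open import Data.Nat using (ℕ; zero; suc; _+_)
  open import Data.Nat.Properties using (+-assoc; +-identityʳ)
  open import Data.Fin using (Fin; zero; suc; fromℕ; inject₁)
  open import Data.List using (List; []; _∷_; map; concatMap; foldr; length; filter; allFin; tabulate; _++_)
  open import Relation.Binary.PropositionalEquality
  open import Function using (_∘_; id)

  𝟙 : Bool → ℕ
  𝟙 true = 1
  𝟙 false = 0

  sumMap : {A : Set} → (A → ℕ) → List A → ℕ
  sumMap f [] = 0
  sumMap f (x ∷ xs) = f x + sumMap f xs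

  count : {A : Set} → (A → Bool) → List A → ℕ
  count p = sumMap (𝟙 ∘ p)

  length-filter≡count : {A : Set} (p : A → Bool) (L : List A) →
    length (filter (λ x → p x ≟B true) L) ≡ count p L
  length-filter≡count p [] = refl
  length-filter≡count p (x ∷ L) with p x
  ... | true = cong suc (length-filter≡count p L)
  ... | false = length-filter≡count p L

  sumMap-cong : {A : Set} {f g : A → ℕ} (L : List A) → (∀ x → f x ≡ g x) → sumMap f L ≡ sumMap g L
  sumMap-cong [] e = refl
  sumMap-cong (x ∷ L) e = cong₂ _+_ (e x) (sumMap-cong L e)

  sumMap-+ : {A : Set} (f g : A → ℕ) (L : List A) → sumMap (λ x → f x + g x) L ≡ sumMap f L + sumMap g L
  sumMap-+ f g [] = refl
  sumMap-+ f g (x ∷ L) = trans (cong (f x + g x +_) (sumMap-+ f g L)) (interchange (f x) (g x) (sumMap f L) (sumMap g L))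

  sumMap-zero : {A : Set} (L : List A) → sumMap (λ _ → 0) L ≡ 0
  sumMap-zero [] = refl
  sumMap-zero (x ∷ L) = sumMap-zero L

  sumMap-++ : {A : Set} (f : A → ℕ) (L M : List A) → sumMap f (L ++ M) ≡ sumMap f L + sumMap f M
  sumMap-++ f [] M = refl
  sumMap-++ f (x ∷ L) M rewrite sumMap-++ f L M = sym (+-assoc (f x) _ _)

  sumMap-map : {A B : Set} (f : B → ℕ) (g : A → B) (L : List A) → sumMap f (map g L) ≡ sumMap (f ∘ g) L
  sumMap-map f g [] = refl
  sumMap-map f g (x ∷ L) = cong (f (g x) +_) (sumMap-map f g L)

  sumMap-concatMap : {A B : Set} (f : B → ℕ) (h : A → List B) (L : List A) →
    sumMap f (concatMap h L) ≡ sumMap (λ x → sumMap f (h x)) L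
  sumMap-concatMap f h [] = refl
  sumMap-concatMap f h (x ∷ L) = trans (sumMap-++ f (h x) (concatMap h L)) (cong (sumMap f (h x) +_) (sumMap-concatMap f h L))

  sumMap-tabulate : {A : Set} {n : ℕ} (f : A → ℕ) (g : Fin n → A) → sumMap f (tabulate g) ≡ sumMap (f ∘ g) (tabulate id)
  sumMap-tabulate f g = go f g id
    where
    go : {A B : Set} {n : ℕ} (f : A → ℕ) (g : B → A) (h : Fin n → B) → sumMap f (tabulate (g ∘ h)) ≡ sumMap (f ∘ g) (tabulate h)
    go {n = zero} f g h = refl
    go {n = suc n} f g h = cong (f (g (h zero)) +_) (go f g (h ∘ suc))

  sumMap-allFin-last : {n : ℕ} (f : Fin (suc n) → ℕ) →
    sumMap f (allFin (suc n)) ≡ sumMap (f ∘ inject₁) (allFin n) + f (fromℕ n)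
  sumMap-allFin-last {n} f = trans (go {n = n} f id) (cong (_+ f (fromℕ n)) (sumMap-tabulate f inject₁))
    where
    go : {A : Set} {n : ℕ} (f : A → ℕ) (g : Fin (suc n) → A) →
         sumMap f (tabulate {n = suc n} g) ≡ sumMap f (tabulate {n = n} (g ∘ inject₁)) + f (g (fromℕ n))
    go {n = zero} f g = +-identityʳ _
    go {n = suc n} f g rewrite go f (g ∘ suc) = sym (+-assoc (f (g zero)) _ _)

  sumMap-allFin-suc : {n : ℕ} (f : Fin (suc n) → ℕ) →
    sumMap f (allFin (suc n)) ≡ f zero + sumMap (f ∘ suc) (allFin n)
  sumMap-allFin-suc f = cong (f zero +_) (sumMap-tabulate f suc)

  ∀ᵇ-elim : {m : ℕ} (p : Fin m → Bool) → ∀ᵇ p ≡ true → ∀ x → p x ≡ true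
  ∀ᵇ-elim {m} p h = go p id h
    where
    go : {A : Set} {n : ℕ} (p : A → Bool) (g : Fin n → A) →
         foldr (λ x b → p x ∧ b) true (tabulate g) ≡ true → ∀ x → p (g x) ≡ true
    go p g h zero = ∧-elimˡ (p (g zero)) h
    go p g h (suc x) = go p (g ∘ suc) (∧-elimʳ (p (g zero)) h) x

  ∀ᵇ-intro : {m : ℕ} (p : Fin m → Bool) → (∀ x → p x ≡ true) → ∀ᵇ p ≡ true
  ∀ᵇ-intro {m} p h = go p id h
    where
    go : {A : Set} {n : ℕ} (p : A → Bool) (g : Fin n → A) →
         (∀ x → p (g x) ≡ true) → foldr (λ x b → p x ∧ b) true (tabulate g) ≡ true
    go {n = zero} p g h = refl
    go {n = suc n} p g h rewrite h zero = go p (g ∘ suc) (h ∘ suc)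

  ∀ᵇ-cong : ∀ {k} (p q : Fin k → Bool) → (∀ x → p x ≡ q x) → ∀ᵇ p ≡ ∀ᵇ q
  ∀ᵇ-cong p q h = ⇔⇒≡ (λ e → ∀ᵇ-intro q (λ x → trans (sym (h x)) (∀ᵇ-elim p e x)))
                      (λ e → ∀ᵇ-intro p (λ x → trans (h x) (∀ᵇ-elim q e x)))

module Sums where

  open import Defs using (sumBelow)
  open Booleans
  open Counting
  open import Data.Bool using (Bool; true; false; _∧_; _∨_)
  open import Data.Empty using (⊥; ⊥-elim)
  open import Data.Bool.Properties using (¬-not; not-¬; T-≡)
  open import Data.Nat using (ℕ; zero; suc; _+_; _≤_; _<_; z≤n; s≤s; _≡ᵇ_; _<ᵇ_; _<?_)
  import Data.Nat.Properties as NP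
  open import Data.Fin using (Fin; zero; suc; _≟_)
  open import Relation.Nullary.Decidable using (⌊_⌋)
  import Data.Fin.Properties as FP
  open import Data.List using (List; []; _∷_; allFin)
  open import Data.Product using (_,_; Σ)
  open import Data.Sum using (_⊎_; inj₁; inj₂)
  open import Function using (_∘_)
  open import Function.Bundles using (Equivalence)
  open import Relation.Nullary using (¬_; yes; no; contradiction)
  open import Relation.Binary.PropositionalEquality

  ≡ᵇ⇒≡ : ∀ {x y} → (x ≡ᵇ y) ≡ true → x ≡ y
  ≡ᵇ⇒≡ {x} {y} e = NP.≡ᵇ⇒≡ x y (Equivalence.from T-≡ e)

  ≡⇒≡ᵇ : ∀ {x y} → x ≡ y → (x ≡ᵇ y) ≡ true
  ≡⇒≡ᵇ {x} {y} e = Equivalence.to T-≡ (NP.≡⇒≡ᵇ x y e)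

  ≡ᵇ-refl : ∀ x → (x ≡ᵇ x) ≡ true
  ≡ᵇ-refl x = ≡⇒≡ᵇ {x} {x} refl

  <ᵇ⇒< : ∀ {x y} → (x <ᵇ y) ≡ true → x < y
  <ᵇ⇒< {x} {y} e = NP.<ᵇ⇒< x y (Equivalence.from T-≡ e)

  <⇒<ᵇ : ∀ {x y} → x < y → (x <ᵇ y) ≡ true
  <⇒<ᵇ lt = Equivalence.to T-≡ (NP.<⇒<ᵇ lt)

  n≢n+1+m : ∀ n m → ¬ n ≡ n + 1 + m
  n≢n+1+m n m e = NP.m≢1+m+n n (trans e (cong (_+ m) (NP.+-comm n 1)))

  𝟙≤1 : ∀ b → 𝟙 b ≤ 1
  𝟙≤1 true = s≤s z≤n
  𝟙≤1 false = z≤n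

  𝟙-∨-disjoint : ∀ a b → (a ≡ true → b ≡ true → ⊥) → 𝟙 (a ∨ b) ≡ 𝟙 a + 𝟙 b
  𝟙-∨-disjoint true true h = ⊥-elim (h refl refl)
  𝟙-∨-disjoint true false h = refl
  𝟙-∨-disjoint false b h = refl

  none-true : false ≡ true ⊎ (false ≡ true ⊎ false ≡ true) → ⊥
  none-true (inj₁ ())
  none-true (inj₂ (inj₁ ()))
  none-true (inj₂ (inj₂ ()))

  𝟙-split₃ : ∀ P a b c → (P ≡ true → a ≡ true ⊎ (b ≡ true ⊎ c ≡ true)) →
    (a ≡ true → P ≡ true) → (b ≡ true → P ≡ true) → (c ≡ true → P ≡ true) →
    (a ≡ true → b ≡ true → ⊥) → (a ≡ true → c ≡ true → ⊥) → (b ≡ true → c ≡ true → ⊥) →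
    𝟙 P ≡ 𝟙 a + 𝟙 b + 𝟙 c
  𝟙-split₃ true true true true h1 ha hb hc xab xac xbc = ⊥-elim (xab refl refl)
  𝟙-split₃ true true true false h1 ha hb hc xab xac xbc = ⊥-elim (xab refl refl)
  𝟙-split₃ true true false true h1 ha hb hc xab xac xbc = ⊥-elim (xac refl refl)
  𝟙-split₃ true true false false h1 ha hb hc xab xac xbc = refl
  𝟙-split₃ true false true true h1 ha hb hc xab xac xbc = ⊥-elim (xbc refl refl)
  𝟙-split₃ true false true false h1 ha hb hc xab xac xbc = refl
  𝟙-split₃ true false false true h1 ha hb hc xab xac xbc = refl
  𝟙-split₃ true false false false h1 ha hb hc xab xac xbc = ⊥-elim (none-true (h1 refl))
  𝟙-split₃ false true true true h1 ha hb hc xab xac xbc = ⊥-elim (xab refl refl)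
  𝟙-split₃ false true true false h1 ha hb hc xab xac xbc = ⊥-elim (xab refl refl)
  𝟙-split₃ false true false true h1 ha hb hc xab xac xbc = ⊥-elim (xac refl refl)
  𝟙-split₃ false true false false h1 ha hb hc xab xac xbc = ⊥-elim (not-¬ (ha refl) refl)
  𝟙-split₃ false false true true h1 ha hb hc xab xac xbc = ⊥-elim (xbc refl refl)
  𝟙-split₃ false false true false h1 ha hb hc xab xac xbc = ⊥-elim (not-¬ (hb refl) refl)
  𝟙-split₃ false false false true h1 ha hb hc xab xac xbc = ⊥-elim (not-¬ (hc refl) refl)
  𝟙-split₃ false false false false h1 ha hb hc xab xac xbc = refl

  𝟙-mono : ∀ {a b} → (a ≡ true → b ≡ true) → 𝟙 a ≤ 𝟙 b
  𝟙-mono {true} f rewrite f refl = NP.≤-refl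
  𝟙-mono {false} f = z≤n

  count-none : {A : Set} (Q : A → Bool) (L : List A) → (∀ a → Q a ≡ false) → count Q L ≡ 0
  count-none Q [] h = refl
  count-none Q (x ∷ L) h rewrite h x = count-none Q L h

  count-mono : {A : Set} (P Q : A → Bool) (L : List A) → (∀ x → P x ≡ true → Q x ≡ true) → count P L ≤ count Q L
  count-mono P Q [] h = z≤n
  count-mono P Q (x ∷ L) h = NP.+-mono-≤ (𝟙-mono (h x)) (count-mono P Q L h)

  count-singleton : {k : ℕ} (y : Fin k) → count (λ x → ⌊ x ≟ y ⌋) (allFin k) ≡ 1
  count-singleton {suc k} zero = trans (sumMap-allFin-suc {n = k} (𝟙 ∘ (λ x → ⌊ x ≟ zero ⌋))) (cong suc (sumMap-zero (allFin k)))
  count-singleton {suc k} (suc y) =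
    trans (sumMap-allFin-suc (𝟙 ∘ (λ x → ⌊ x ≟ suc y ⌋)))
          (trans (sumMap-cong (allFin k) (λ x → cong 𝟙 (⌊suc≟suc⌋ x))) (count-singleton y))
    where
    ⌊suc≟suc⌋ : ∀ x → ⌊ suc x ≟ suc y ⌋ ≡ ⌊ x ≟ y ⌋
    ⌊suc≟suc⌋ x with x ≟ y
    ... | yes _ = refl
    ... | no _ = refl

  count≤1 : ∀ {k} (Q : Fin k → Bool) → (∀ a b → Q a ≡ true → Q b ≡ true → a ≡ b) → count Q (allFin k) ≤ 1
  count≤1 {zero} Q h = z≤n
  count≤1 {suc k} Q h rewrite sumMap-allFin-suc (𝟙 ∘ Q) with Q zero in q0
  ... | true rewrite count-none (Q ∘ suc) (allFin k) (λ b → ¬-not (λ e → FP.0≢1+n (h zero (suc b) q0 e))) = s≤s z≤n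
  ... | false = count≤1 (Q ∘ suc) (λ a b e f → FP.suc-injective (h (suc a) (suc b) e f))

  count≡0⇒none : ∀ {k} (Q : Fin k → Bool) → count Q (allFin k) ≡ 0 → ∀ x → Q x ≡ false
  count≡0⇒none {suc k} Q e x with Q zero in q0 | trans (sym (sumMap-allFin-suc (𝟙 ∘ Q))) e
  count≡0⇒none {suc k} Q e zero | false | _ = q0
  count≡0⇒none {suc k} Q e (suc x) | false | rest = count≡0⇒none (Q ∘ suc) rest x

  count≢0⇒some : ∀ {k} (Q : Fin k → Bool) → ¬ count Q (allFin k) ≡ 0 → Σ (Fin k) λ y → Q y ≡ true
  count≢0⇒some {zero} Q n = contradiction refl n
  count≢0⇒some {suc k} Q n with Q zero in q0
  ... | true = zero , q0
  ... | false with count≢0⇒some (Q ∘ suc) (λ e → n (trans (sumMap-tabulate (𝟙 ∘ Q) suc) e))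
  ...   | y , Qy = suc y , Qy

  count-< : ∀ {k} (P Q : Fin k → Bool) → (∀ x → P x ≡ true → Q x ≡ true) →
            (y : Fin k) → Q y ≡ true → P y ≡ false → count P (allFin k) < count Q (allFin k)
  count-< {suc k} P Q h y Qy Py rewrite sumMap-allFin-suc (𝟙 ∘ P) | sumMap-allFin-suc (𝟙 ∘ Q) with y
  ... | zero rewrite Qy | Py = s≤s (count-mono (P ∘ suc) (Q ∘ suc) (allFin k) (h ∘ suc))
  ... | suc y′ = NP.+-mono-≤-< (𝟙-mono (h zero)) (count-< (P ∘ suc) (Q ∘ suc) (h ∘ suc) y′ Qy Py)

  sumBelow-zero : ∀ N → sumBelow N (λ _ → 0) ≡ 0
  sumBelow-zero zero = refl
  sumBelow-zero (suc N) = cong (_+ 0) (sumBelow-zero N)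

  sumBelow-cong : ∀ N (g h : ℕ → ℕ) → (∀ s → s < N → g s ≡ h s) → sumBelow N g ≡ sumBelow N h
  sumBelow-cong zero g h e = refl
  sumBelow-cong (suc N) g h e = cong₂ _+_ (sumBelow-cong N g h (λ s lt → e s (NP.m≤n⇒m≤1+n lt))) (e N NP.≤-refl)

  sumBelow-none : ∀ N (G : ℕ → Bool) → (∀ s → s < N → G s ≡ false) → sumBelow N (𝟙 ∘ G) ≡ 0
  sumBelow-none N G h = trans (sumBelow-cong N (𝟙 ∘ G) (λ _ → 0) (λ s lt → cong 𝟙 (h s lt))) (sumBelow-zero N)

  sumBelow-false-∧ : ∀ {b} → b ≡ false → ∀ t (g : ℕ → Bool) → sumBelow t (λ s → 𝟙 (b ∧ g s)) ≡ 0
  sumBelow-false-∧ refl t g = sumBelow-zero t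

  sumBelow-true-∧ : ∀ {b} → b ≡ true → ∀ t (g : ℕ → Bool) → sumBelow t (λ s → 𝟙 (b ∧ g s)) ≡ sumBelow t (λ s → 𝟙 (g s))
  sumBelow-true-∧ refl t g = refl

  sumBelow-single : ∀ N (G : ℕ → Bool) t → (∀ s → G s ≡ true → s ≡ t) → t < N → sumBelow N (𝟙 ∘ G) ≡ 𝟙 (G t)
  sumBelow-single (suc N) G t h (s≤s t≤N) with NP.m≤n⇒m<n∨m≡n t≤N
  ... | inj₁ t<N = trans (cong₂ _+_ (sumBelow-single N G t h t<N) (cong 𝟙 (¬-not (λ e → NP.<-irrefl (sym (h N e)) t<N)))) (NP.+-identityʳ _)
  ... | inj₂ refl = cong (_+ 𝟙 (G t)) (sumBelow-none t G (λ s lt → ¬-not (λ e → NP.<-irrefl (h s e) lt)))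

  sumBelow-support₁ : ∀ N (G : ℕ → Bool) t → (∀ s → G s ≡ true → s ≡ t) → sumBelow N (𝟙 ∘ G) ≡ 𝟙 ((t <ᵇ N) ∧ G t)
  sumBelow-support₁ N G t h with t <? N
  ... | yes t<N rewrite <⇒<ᵇ t<N = sumBelow-single N G t h t<N
  ... | no t≮N rewrite ¬-not {t <ᵇ N} (t≮N ∘ <ᵇ⇒<) =
        sumBelow-none N G (λ s lt → ¬-not (λ e → NP.<-irrefl (h s e) (NP.<-≤-trans lt (NP.≮⇒≥ t≮N))))

  sumBelow-≤ : ∀ N (v : ℕ → ℕ) → (∀ s → v s ≤ 1) → sumBelow N v ≤ N
  sumBelow-≤ zero v h = z≤n
  sumBelow-≤ (suc N) v h = subst (sumBelow N v + v N ≤_) (NP.+-comm N 1) (NP.+-mono-≤ (sumBelow-≤ N v h) (h N))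

  sumBelow≡N⇒all-one : ∀ N (v : ℕ → ℕ) → (∀ s → v s ≤ 1) → sumBelow N v ≡ N → ∀ s → s < N → v s ≡ 1
  sumBelow≡N⇒all-one (suc N) v h e s lt
    with NP.m≤n⇒m<n∨m≡n (sumBelow-≤ N v h) | NP.m≤n⇒m<n∨m≡n (h N)
  ... | inj₁ below | _ = contradiction e (NP.<⇒≢ (subst (sumBelow N v + v N <_) (NP.+-comm N 1) (NP.+-mono-<-≤ below (h N))))
  ... | inj₂ _ | inj₁ below = contradiction e (NP.<⇒≢ (subst (sumBelow N v + v N <_) (NP.+-comm N 1) (NP.+-mono-≤-< (sumBelow-≤ N v h) below)))
  ... | inj₂ full | inj₂ one with NP.m≤n⇒m<n∨m≡n (NP.≤-pred lt)
  ...   | inj₁ s<N = sumBelow≡N⇒all-one N v h full s s<N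
  ...   | inj₂ refl = one

  sumMap-sumBelow : {A : Set} (b : ℕ) (g : A → ℕ → ℕ) (L : List A) →
    sumMap (λ x → sumBelow b (g x)) L ≡ sumBelow b (λ s → sumMap (λ x → g x s) L)
  sumMap-sumBelow zero g L = sumMap-zero L
  sumMap-sumBelow (suc b) g L =
    trans (sumMap-+ (λ x → sumBelow b (g x)) (λ x → g x b) L) (cong (_+ sumMap (λ x → g x b) L) (sumMap-sumBelow b g L))
module InjectiveCounting where

  open Counting
  open import Defs using (allFuns)
  open import Data.Bool using (Bool; true; false)
  open import Data.Nat using (ℕ; zero; suc; _+_; _≤_; z≤n; s≤s)
  open import Data.Nat.Properties using (≤-refl; ≤-reflexive; ≤-trans; +-monoʳ-≤; +-suc)
  open import Data.Fin using (zero; suc)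
  open import Data.List using (List; []; _∷_; map; concatMap; length)
  open import Data.List.Relation.Unary.All using (All; []; _∷_)
  open import Data.List.Relation.Unary.Any using (Any; here; there)
  import Data.List.Relation.Unary.All as All
  import Data.List.Relation.Unary.Any as Any
  import Data.List.Relation.Unary.Any.Properties as AnyP
  import Data.List.Relation.Unary.All.Properties as AllP
  open import Data.List.Relation.Unary.AllPairs using (AllPairs; []; _∷_)
  import Data.List.Relation.Unary.AllPairs as AllPairs
  import Data.List.Relation.Unary.AllPairs.Properties as APP
  open import Data.Product using (_×_; _,_; proj₁; proj₂; Σ)
  open import Data.Vec.Functional.Relation.Binary.Pointwise using (Pointwise)
  import Data.Vec.Functional.Relation.Binary.Pointwise.Properties as PW
  open import Data.Empty using (⊥-elim)
  open import Relation.Binary.Structures using (IsEquivalence)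
  open import Relation.Nullary using (¬_; Dec; yes; no)
  open import Relation.Binary.PropositionalEquality
  open import Function using (_∘_)

  DistinctUpTo : {A : Set} → (A → A → Set) → List A → Set
  DistinctUpTo R = AllPairs (λ x y → ¬ R x y)

  CompleteUpTo : {A : Set} → (A → A → Set) → List A → Set
  CompleteUpTo R L = ∀ x → Any (R x) L

  module _ {B : Set} {S : B → B → Set} (eqS : IsEquivalence S) (S? : ∀ x y → Dec (S x y)) (q : B → Bool)
           (qresp : ∀ {y y'} → S y y' → q y ≡ true → q y' ≡ true) where
    open IsEquivalence eqS using () renaming (sym to S-sym; trans to S-trans)

    remove-match : (y : B) (M : List B) (K : List B) → DistinctUpTo S K → All (λ k → q k ≡ true) K →
            All (λ k → Any (S k) (y ∷ M)) K →
            Σ (List B) λ K2 → DistinctUpTo S K2 × All (λ k → q k ≡ true) K2 × All (λ k → Any (S k) M) K2 ×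
              (length K ≤ 𝟙 (q y) + length K2) × (∀ {P : B → Set} → All P K → All P K2)
    remove-match y M [] u a c = [] , [] , [] , [] , z≤n , λ _ → []
    remove-match y M (k ∷ K) (hu ∷ u) (qk ∷ a) (ck ∷ c) with S? k y
    ... | yes s rewrite qresp s qk = K , u , a , rest K hu c , ≤-refl , λ { (_ ∷ ps) → ps }
      where
      rest : (K' : List B) → All (λ k' → ¬ S k k') K' → All (λ k' → Any (S k') (y ∷ M)) K' → All (λ k' → Any (S k') M) K'
      rest [] _ _ = []
      rest (k' ∷ K') (n ∷ ns) (here s' ∷ cs) = ⊥-elim (n (S-trans s (S-sym s')))
      rest (k' ∷ K') (n ∷ ns) (there p ∷ cs) = p ∷ rest K' ns cs
    ... | no ns with remove-match y M K u a c
    ... | K2 , u2 , a2 , c2 , le , sub = k ∷ K2 , (sub hu ∷ u2) , (qk ∷ a2) , (there' ck ∷ c2) ,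
          ≤-trans (s≤s le) (≤-reflexive (sym (+-suc (𝟙 (q y)) (length K2)))) , λ { (p ∷ ps) → p ∷ sub ps }
      where
      there' : Any (S k) (y ∷ M) → Any (S k) M
      there' (here s) = ⊥-elim (ns s)
      there' (there p) = p

    distinct-length≤count : (M : List B) (K : List B) → DistinctUpTo S K → All (λ k → q k ≡ true) K → All (λ k → Any (S k) M) K →
        length K ≤ count q M
    distinct-length≤count [] [] u a c = z≤n
    distinct-length≤count [] (k ∷ K) u a (() ∷ c)
    distinct-length≤count (y ∷ M) K u a c with remove-match y M K u a c
    ... | K2 , u2 , a2 , c2 , le , _ = ≤-trans le (+-monoʳ-≤ (𝟙 (q y)) (distinct-length≤count M K2 u2 a2 c2))

  module _ {A B : Set} {R : A → A → Set} {S : B → B → Set} (eqS : IsEquivalence S) (S? : ∀ x y → Dec (S x y))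
           (p : A → Bool) (q : B → Bool)
           (qresp : ∀ {y y'} → S y y' → q y ≡ true → q y' ≡ true)
           (φ : A → B) (pq : ∀ x → p x ≡ true → q (φ x) ≡ true)
           (inj : ∀ x x' → p x ≡ true → p x' ≡ true → S (φ x) (φ x') → R x x') where

    distinct-image : (M : List B) → CompleteUpTo S M → (L : List A) → DistinctUpTo R L →
            Σ (List B) λ K → length K ≡ count p L × DistinctUpTo S K × All (λ k → q k ≡ true) K × All (λ k → Any (S k) M) K ×
               (∀ {P : B → Set} → All (λ x → p x ≡ true → P (φ x)) L → All P K)
    distinct-image M cM [] u = [] , refl , [] , [] , [] , λ _ → []
    distinct-image M cM (x ∷ L) (hu ∷ u) with p x in px | distinct-image M cM L u
    ... | true | K , len , uK , aK , cK , sub = φ x ∷ K , cong suc len ,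
            (sub (hd L hu) ∷ uK) , (pq x px ∷ aK) , (cM (φ x) ∷ cK) , λ { (h ∷ hs) → h px ∷ sub hs }
      where
      hd : (L' : List A) → All (λ y → ¬ R x y) L' → All (λ x' → p x' ≡ true → ¬ S (φ x) (φ x')) L'
      hd [] [] = []
      hd (x' ∷ L') (n ∷ ns) = (λ px' s → n (inj x x' px px' s)) ∷ hd L' ns
    ... | false | K , len , uK , aK , cK , sub = K , len , uK , aK , cK , λ { (h ∷ hs) → sub hs }

    count≤count-of-injection : (L : List A) → DistinctUpTo R L → (M : List B) → CompleteUpTo S M → count p L ≤ count q M
    count≤count-of-injection L uL M cM with distinct-image M cM L uL
    ... | K , len , uK , aK , cK , _ = subst (_≤ count q M) len (distinct-length≤count eqS S? q qresp M K uK aK cK)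

  module _ {A B C : Set} {RA : A → A → Set} {RB : B → B → Set} {RC : C → C → Set} where
    pairs-distinct : (g : A → B → C) → (∀ {a a' b b'} → RC (g a b) (g a' b') → RA a a' × RB b b') →
                (xs : List A) → DistinctUpTo RA xs → (L2 : List B) → DistinctUpTo RB L2 →
                DistinctUpTo RC (concatMap (λ a → map (g a) L2) xs)
    pairs-distinct g ginj xs u1 L2 u2 = APP.concat⁺ (blocks xs) (APP.map⁺ (AllPairs.map cross u1))
      where
      blocks : (L : List A) → All (DistinctUpTo RC) (map (λ a → map (g a) L2) L)
      blocks [] = []
      blocks (a ∷ L) = APP.map⁺ (AllPairs.map (λ nb e → nb (proj₂ (ginj e))) u2) ∷ blocks L
      cross : ∀ {a a'} → ¬ RA a a' → All (λ x → All (λ y → ¬ RC x y) (map (g a') L2)) (map (g a) L2)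
      cross na = AllP.map⁺ (All.universal (λ b → AllP.map⁺ (All.universal (λ b' e → na (proj₁ (ginj e))) L2)) L2)

    pairs-complete : (g : A → B → C) → (∀ c → Σ A λ a → Σ B λ b → RC c (g a b)) →
                 (∀ {a a' b b'} → RA a a' → RB b b' → RC (g a b) (g a' b')) →
                 (∀ {x y z} → RC x y → RC y z → RC x z) →
                 (xs : List A) → CompleteUpTo RA xs → (L2 : List B) → CompleteUpTo RB L2 →
                 CompleteUpTo RC (concatMap (λ a → map (g a) L2) xs)
    pairs-complete g gs gr trC xs c1 L2 c2 c with gs c
    ... | a , b , e = AnyP.concat⁺ (AnyP.map⁺ (Any.map (λ ra → AnyP.map⁺ (Any.map (λ rb → trC e (gr ra rb)) (c2 b))) (c1 a)))

  allFuns-distinct : {A : Set} {R : A → A → Set} (as : List A) → DistinctUpTo R as → (n : ℕ) → DistinctUpTo (Pointwise R {n}) (allFuns as n)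
  allFuns-distinct as u zero = [] ∷ []
  allFuns-distinct as u (suc n) = pairs-distinct _ (λ e → e zero , λ i → e (suc i)) as u (allFuns as n) (allFuns-distinct as u n)

  allFuns-complete : {A : Set} {R : A → A → Set} → IsEquivalence R → (as : List A) → CompleteUpTo R as →
                     (n : ℕ) → CompleteUpTo (Pointwise R {n}) (allFuns as n)
  allFuns-complete e as c zero f = here (λ ())
  allFuns-complete e as c (suc n) =
    pairs-complete _ (λ f → f zero , (f ∘ suc) , λ { zero → IsEquivalence.refl e ; (suc i) → IsEquivalence.refl e })
      (λ ra rb → λ { zero → ra ; (suc i) → rb i }) (IsEquivalence.trans (PW.isEquivalence e (suc n)))
      as c (allFuns as n) (allFuns-complete e as c n)

module CyclicOrder where

  open import Defs
  open Booleans
  open Counting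
  open Sums
  open import Data.Bool.Properties using (¬-not; not-¬)
  open import Data.Bool using (Bool; true; false; _∧_; _∨_; not)
  open import Data.Nat using (ℕ; suc; _+_; _≤_; s≤s; _≡ᵇ_)
  import Data.Nat.Properties
  import Data.Fin.Properties
  open import Data.Nat.Properties using (+-comm; +-identityʳ; +-suc; m≤m+n; 0≢1+n; suc-injective)
  open import Data.Fin using (Fin; suc; _≟_)
  open import Data.List using (allFin)
  open import Data.Product using (_×_; _,_; proj₁; proj₂)
  open import Data.Sum using (_⊎_; inj₁; inj₂; [_,_])
  open import Data.Empty using (⊥; ⊥-elim)
  open import Relation.Nullary using (¬_; yes; no; contradiction)
  open import Relation.Nullary.Decidable using (⌊_⌋)
  open import Relation.Binary.PropositionalEquality hiding ([_])
  open import Function using (_∘_)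

  record IsCyclicOrder {A : Set} (Z : A → A → A → Bool) : Set where
    field
      dist : ∀ {x y z} → Z x y z ≡ true → (¬ x ≡ y) × (¬ y ≡ z) × (¬ x ≡ z)
      cyc : ∀ {x y z} → Z x y z ≡ true → Z y z x ≡ true
      asym : ∀ {x y z} → Z x y z ≡ true → Z z y x ≡ false
      trn : ∀ {x y z u} → Z x y z ≡ true → Z x z u ≡ true → Z x y u ≡ true
      total : ∀ {x y z} → ¬ x ≡ y → ¬ y ≡ z → ¬ x ≡ z → (Z x y z ≡ true) ⊎ (Z z y x ≡ true)

  distinctᵇ-elim : {m : ℕ} {x y z : Fin m} → distinctᵇ x y z ≡ true → (¬ x ≡ y) × (¬ y ≡ z) × (¬ x ≡ z)
  distinctᵇ-elim {x = x} {y} {z} h with ∧-elimˡ (not ⌊ x ≟ y ⌋) h | ∧-elimʳ (not ⌊ x ≟ y ⌋) h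
  ... | x≢y | h′ = ⌊≟⌋-false⇒≢ (not-elim x≢y) , ⌊≟⌋-false⇒≢ (not-elim (∧-elimˡ (not ⌊ y ≟ z ⌋) h′)) ,
                   ⌊≟⌋-false⇒≢ (not-elim (∧-elimʳ (not ⌊ y ≟ z ⌋) h′))

  distinctᵇ-intro : {m : ℕ} {x y z : Fin m} → ¬ x ≡ y → ¬ y ≡ z → ¬ x ≡ z → distinctᵇ x y z ≡ true
  distinctᵇ-intro a b c = ∧-intro (not-intro (⌊≟⌋-false a)) (∧-intro (not-intro (⌊≟⌋-false b)) (not-intro (⌊≟⌋-false c)))

  axiomsAt : {m : ℕ} → Triples m → Fin m → Fin m → Fin m → Bool
  axiomsAt Z x y z =
         (Z x y z ⇒ᵇ distinctᵇ x y z)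
      ∧ (Z x y z ⇒ᵇ Z y z x)
      ∧ (Z x y z ⇒ᵇ not (Z z y x))
      ∧ (∀ᵇ λ u → (Z x y z ∧ Z x z u) ⇒ᵇ Z x y u)
      ∧ (distinctᵇ x y z ⇒ᵇ (Z x y z ∨ Z z y x))

  ∧₅-elim : ∀ {a b c d e} → (a ∧ b ∧ c ∧ d ∧ e) ≡ true →
            a ≡ true × b ≡ true × c ≡ true × d ≡ true × e ≡ true
  ∧₅-elim {true} {true} {true} {true} {true} _ = refl , refl , refl , refl , refl

  isTotalCyclicOrder⇒IsCyclicOrder : {m : ℕ} (Z : Triples m) → isTotalCyclicOrder Z ≡ true → IsCyclicOrder Z
  isTotalCyclicOrder⇒IsCyclicOrder Z h = record
    { dist = λ {x} {y} {z} e → distinctᵇ-elim (⇒ᵇ-elim (Z x y z) (proj₁ (axioms x y z)) e)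
    ; cyc = λ {x} {y} {z} e → ⇒ᵇ-elim (Z x y z) (proj₁ (proj₂ (axioms x y z))) e
    ; asym = λ {x} {y} {z} e → not-elim (⇒ᵇ-elim (Z x y z) (proj₁ (proj₂ (proj₂ (axioms x y z)))) e)
    ; trn = λ {x} {y} {z} {u} e f → ⇒ᵇ-elim (Z x y z ∧ Z x z u)
              (∀ᵇ-elim (λ u → (Z x y z ∧ Z x z u) ⇒ᵇ Z x y u) (proj₁ (proj₂ (proj₂ (proj₂ (axioms x y z))))) u) (∧-intro e f)
    ; total = λ {x} {y} {z} a b c → ∨-elim (⇒ᵇ-elim (distinctᵇ x y z) (proj₂ (proj₂ (proj₂ (proj₂ (axioms x y z))))) (distinctᵇ-intro a b c))
    }
    where
    axioms : ∀ x y z → (Z x y z ⇒ᵇ distinctᵇ x y z) ≡ true × (Z x y z ⇒ᵇ Z y z x) ≡ true ×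
                       (Z x y z ⇒ᵇ not (Z z y x)) ≡ true × (∀ᵇ λ u → (Z x y z ∧ Z x z u) ⇒ᵇ Z x y u) ≡ true ×
                       (distinctᵇ x y z ⇒ᵇ (Z x y z ∨ Z z y x)) ≡ true
    axioms x y z = ∧₅-elim (∀ᵇ-elim (axiomsAt Z x y) (∀ᵇ-elim (λ y → ∀ᵇ (axiomsAt Z x y)) (∀ᵇ-elim (λ x → ∀ᵇ λ y → ∀ᵇ (axiomsAt Z x y)) h x) y) z)

  IsCyclicOrder⇒isTotalCyclicOrder : {m : ℕ} (Z : Triples m) → IsCyclicOrder Z → isTotalCyclicOrder Z ≡ true
  IsCyclicOrder⇒isTotalCyclicOrder Z T = ∀ᵇ-intro (λ x → ∀ᵇ λ y → ∀ᵇ (axiomsAt Z x y)) λ x → ∀ᵇ-intro (λ y → ∀ᵇ (axiomsAt Z x y)) λ y → ∀ᵇ-intro (axiomsAt Z x y) λ z →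
    ∧-intro (⇒ᵇ-intro (Z x y z) _ (λ e → let (a , b , c) = dist e in distinctᵇ-intro a b c))
    (∧-intro (⇒ᵇ-intro (Z x y z) _ cyc)
    (∧-intro (⇒ᵇ-intro (Z x y z) _ (λ e → not-intro (asym e)))
    (∧-intro (∀ᵇ-intro (λ u → (Z x y z ∧ Z x z u) ⇒ᵇ Z x y u) (λ u → ⇒ᵇ-intro (Z x y z ∧ Z x z u) _ (λ e → trn (∧-elimˡ (Z x y z) e) (∧-elimʳ (Z x y z) e))))
         (⇒ᵇ-intro (distinctᵇ x y z) _ (λ e → let (a , b , c) = distinctᵇ-elim e in [ ∨-introˡ , ∨-introʳ ] (total a b c))))))
    where
    open IsCyclicOrder T

  content′ : {m : ℕ} → Triples m → Fin m → Fin m → ℕ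
  content′ {m} Z a b = count (λ x → Z a x b) (allFin m)

  content≡content′ : {m : ℕ} (Z : Triples m) (a b : Fin m) → content Z a b ≡ content′ Z a b
  content≡content′ {m} Z a b = length-filter≡count (λ x → Z a x b) (allFin m)

  -- arc Z X Y is the half-open arc [X, Y); position Z X a counts the points of [X, a).
  arc : {m : ℕ} → Triples m → Fin m → Fin m → Fin m → Bool
  arc Z X Y a = ⌊ a ≟ X ⌋ ∨ Z X a Y

  position : {m : ℕ} → Triples m → Fin m → Fin m → ℕ
  position Z X a = content′ Z X a + 𝟙 (not ⌊ a ≟ X ⌋)

  module Geometry {m : ℕ} {Z : Triples m} (T : IsCyclicOrder Z) where
    open IsCyclicOrder T public

    cyc² : ∀ {x y z} → Z x y z ≡ true → Z z x y ≡ true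
    cyc² e = cyc (cyc e)

    cyc-≡ : ∀ x y z → Z x y z ≡ Z y z x
    cyc-≡ x y z = ⇔⇒≡ cyc cyc²

    ≢₁₂ : ∀ {x y z} → Z x y z ≡ true → ¬ x ≡ y
    ≢₁₂ e = proj₁ (dist e)
    ≢₂₃ : ∀ {x y z} → Z x y z ≡ true → ¬ y ≡ z
    ≢₂₃ e = proj₁ (proj₂ (dist e))
    ≢₁₃ : ∀ {x y z} → Z x y z ≡ true → ¬ x ≡ z
    ≢₁₃ e = proj₂ (proj₂ (dist e))

    asym-⊥ : ∀ {x y z} → Z x y z ≡ true → Z z y x ≡ true → ⊥
    asym-⊥ e f = not-¬ f (asym e)

    between-widen : ∀ {x y z w} → Z y w z ≡ true → Z x y z ≡ true → Z x w z ≡ true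
    between-widen e f = cyc (trn (cyc² f) (cyc² e))

    between-exclusive : ∀ {x y z w} → Z x y z ≡ true → Z x w y ≡ true → Z y w z ≡ true → ⊥
    between-exclusive f a c = asym-⊥ a (trn c (cyc f))

    between-split : ∀ {x y z w} → Z x w z ≡ true → Z x y z ≡ true → ¬ w ≡ y → (Z x w y ≡ true) ⊎ (Z y w z ≡ true)
    between-split {x} {y} {z} {w} e f n with total {x} {w} {y} (≢₁₂ e) n (≢₁₂ f)
    ... | inj₁ a = inj₁ a
    ... | inj₂ b with total {y} {w} {z} (λ q → n (sym q)) (≢₂₃ e) (≢₂₃ f)
    ...   | inj₁ c = inj₂ c
    ...   | inj₂ d = ⊥-elim (asym-⊥ e (cyc² (trn (cyc b) (cyc d))))

    𝟙-between-split : ∀ {x y z} → Z x y z ≡ true → ∀ w → 𝟙 (Z x w z) ≡ 𝟙 (Z x w y) + 𝟙 ⌊ w ≟ y ⌋ + 𝟙 (Z y w z)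
    𝟙-between-split {x} {y} {z} f w = 𝟙-split₃ (Z x w z) (Z x w y) ⌊ w ≟ y ⌋ (Z y w z) h1
        (λ a → trn a f) (λ b → subst (λ q → Z x q z ≡ true) (sym (⌊≟⌋-true⇒≡ b)) f) (λ c → between-widen c f)
        (λ a b → ≢₂₃ a (⌊≟⌋-true⇒≡ b)) (λ a c → between-exclusive f a c) (λ b c → ≢₁₂ c (sym (⌊≟⌋-true⇒≡ b)))
      where
      h1 : Z x w z ≡ true → Z x w y ≡ true ⊎ (⌊ w ≟ y ⌋ ≡ true ⊎ Z y w z ≡ true)
      h1 e with w ≟ y
      ... | yes p = inj₂ (inj₁ refl)
      ... | no n with between-split e f n
      ...   | inj₁ a = inj₁ a
      ...   | inj₂ c = inj₂ (inj₂ c)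

    content′-additive : ∀ {x y z} → Z x y z ≡ true → content′ Z x z ≡ content′ Z x y + 1 + content′ Z y z
    content′-additive {x} {y} {z} f =
      trans (sumMap-cong (allFin m) (𝟙-between-split f))
     (trans (sumMap-+ (λ w → 𝟙 (Z x w y) + 𝟙 ⌊ w ≟ y ⌋) (λ w → 𝟙 (Z y w z)) (allFin m))
       (cong (_+ content′ Z y z) (trans (sumMap-+ (λ w → 𝟙 (Z x w y)) (λ w → 𝟙 ⌊ w ≟ y ⌋) (allFin m))
          (cong (content′ Z x y +_) (count-singleton y)))))

    content′-self : ∀ X → content′ Z X X ≡ 0
    content′-self X = count-none (λ w → Z X w X) (allFin m) (λ w → ¬-not (λ e → ≢₁₃ e refl))

    arc-ne : ∀ {X Y a} → ¬ a ≡ X → arc Z X Y a ≡ Z X a Y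
    arc-ne {X} {Y} {a} n rewrite ⌊≟⌋-false n = refl

    arc-split : ∀ {P Q R} → Z P Q R ≡ true → ∀ a →
                𝟙 (arc Z P R a) ≡ 𝟙 (arc Z P Q a) + 𝟙 (arc Z Q R a)
    arc-split {P} {Q} {R} f a with a ≟ P
    ... | yes refl rewrite ⌊≟⌋-false {x = a} {y = Q} (≢₁₂ f) | ¬-not {Z Q a R} (λ e → asym-⊥ (cyc f) (cyc e)) = refl
    ... | no np with a ≟ Q
    ...   | yes refl rewrite f | ¬-not {Z P a a} (λ e → ≢₂₃ e refl) = refl
    ...   | no nq = trans (𝟙-between-split f a) (trans (cong (λ b → 𝟙 (Z P a Q) + 𝟙 b + 𝟙 (Z Q a R)) (⌊≟⌋-false nq)) (cong (_+ 𝟙 (Z Q a R)) (+-identityʳ _)))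

    arc-complement : ∀ {P R} → ¬ P ≡ R → ∀ a → 𝟙 (arc Z P R a) + 𝟙 (arc Z R P a) ≡ 1
    arc-complement {P} {R} n a with a ≟ P
    ... | yes refl rewrite ⌊≟⌋-false n | ¬-not {Z R a a} (λ e → ≢₂₃ e refl) = refl
    ... | no np with a ≟ R
    ...   | yes refl rewrite ¬-not {Z P a a} (λ e → ≢₂₃ e refl) = refl
    ...   | no nr with total {P} {a} {R} (λ e → np (sym e)) nr n
    ...     | inj₁ e rewrite e | asym e = refl
    ...     | inj₂ e rewrite e | asym e = refl

    arc-disjoint : ∀ {P Q R} → Z P Q R ≡ true → ∀ a → arc Z P Q a ≡ true → arc Z Q R a ≡ true → ⊥
    arc-disjoint {P} {Q} {R} f a e1 e2 with 𝟙≤1 (arc Z P R a)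
    ... | le rewrite arc-split f a | e1 | e2 with le
    ...   | s≤s ()

    position-≢ : ∀ {X a} → ¬ a ≡ X → position Z X a ≡ suc (content′ Z X a)
    position-≢ {X} {a} n rewrite ⌊≟⌋-false n = +-comm (content′ Z X a) 1

    position-cases : ∀ X a → (a ≡ X × position Z X a ≡ 0) ⊎ (¬ a ≡ X × position Z X a ≡ suc (content′ Z X a))
    position-cases X a with a ≟ X
    ... | yes refl = inj₁ (refl , trans (+-identityʳ _) (content′-self a))
    ... | no a≢X = inj₂ (a≢X , +-comm (content′ Z X a) 1)

    position+content′ : ∀ {X Y a} → arc Z X Y a ≡ true → position Z X a + content′ Z a Y ≡ content′ Z X Y
    position+content′ {X} {Y} {a} e with position-cases X a
    ... | inj₁ (refl , p) = cong (_+ content′ Z a Y) p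
    ... | inj₂ (a≢X , p) rewrite p = sym (trans (content′-additive (subst (_≡ true) (arc-ne a≢X) e)) (cong (_+ content′ Z a Y) (+-comm (content′ Z X a) 1)))

    content′-position : ∀ {W X Y a} → Z W X Y ≡ true → arc Z X Y a ≡ true → content′ Z W a + 1 ≡ content′ Z W X + 1 + position Z X a
    content′-position {W} {X} {Y} {a} f e with position-cases X a
    ... | inj₁ (refl , p) = sym (trans (cong (content′ Z W a + 1 +_) p) (+-identityʳ _))
    ... | inj₂ (a≢X , p) rewrite p | content′-additive (cyc² (trn (subst (_≡ true) (arc-ne a≢X) e) (cyc f))) =
          trans (+-comm (content′ Z W X + 1 + content′ Z X a) 1) (sym (+-suc (content′ Z W X + 1) (content′ Z X a)))

    arc-size : ∀ {X Y} → count (arc Z X Y) (allFin m) ≡ suc (content′ Z X Y)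
    arc-size {X} {Y} =
      trans (sumMap-cong (allFin m) (λ a → 𝟙-∨-disjoint ⌊ a ≟ X ⌋ (Z X a Y) (λ e f → ≢₁₂ f (sym (⌊≟⌋-true⇒≡ e)))))
     (trans (sumMap-+ (λ a → 𝟙 ⌊ a ≟ X ⌋) (λ a → 𝟙 (Z X a Y)) (allFin m))
            (cong (_+ content′ Z X Y) (count-singleton X)))

    position≤content′ : ∀ {X Y a} → arc Z X Y a ≡ true → position Z X a ≤ content′ Z X Y
    position≤content′ {X} {Y} {a} e = subst (position Z X a ≤_) (position+content′ e) (m≤m+n (position Z X a) (content′ Z a Y))

    position-injective : ∀ {X Y a b} → arc Z X Y a ≡ true → arc Z X Y b ≡ true → position Z X a ≡ position Z X b → a ≡ b
    position-injective {X} {Y} {a} {b} ea eb et with a ≟ b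
    ... | yes a≡b = a≡b
    ... | no a≢b with position-cases X a | position-cases X b
    ...   | inj₁ (refl , _) | inj₁ (refl , _) = refl
    ...   | inj₁ (refl , pa) | inj₂ (_ , pb) = contradiction (trans (sym pa) (trans et pb)) 0≢1+n
    ...   | inj₂ (_ , pa) | inj₁ (refl , pb) = contradiction (trans (sym pb) (trans (sym et) pa)) 0≢1+n
    ...   | inj₂ (a≢X , pa) | inj₂ (b≢X , pb) with total {X} {a} {b} (a≢X ∘ sym) a≢b (b≢X ∘ sym)
    ...     | inj₁ Xab = ⊥-elim (n≢n+1+m (content′ Z X a) (content′ Z a b)
                (trans (suc-injective (trans (sym pa) (trans et pb))) (content′-additive Xab)))
    ...     | inj₂ baX = ⊥-elim (n≢n+1+m (content′ Z X b) (content′ Z b a)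
                (trans (suc-injective (trans (sym pb) (trans (sym et) pa))) (content′-additive (cyc² baX))))

    arc-≢end : ∀ {X Y a} → ¬ X ≡ Y → arc Z X Y a ≡ true → ¬ a ≡ Y
    arc-≢end {X} {Y} {a} n e with ∨-elim {⌊ a ≟ X ⌋} e
    ... | inj₁ p = λ q → n (trans (sym (⌊≟⌋-true⇒≡ p)) q)
    ... | inj₂ p = ≢₂₃ p

    arc-end-≢ : ∀ {X Y a} → ¬ X ≡ Y → arc Z X Y a ≡ true → ¬ Y ≡ a
    arc-end-≢ n e q = arc-≢end n e (sym q)

    arc-reverse-false : ∀ {X Y a} → ¬ X ≡ Y → arc Z X Y a ≡ true → arc Z Y X a ≡ false
    arc-reverse-false {X} {Y} {a} n e with arc-complement n a
    ... | c rewrite e = ¬-not (λ f → go (arc Z Y X a) f c)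
      where
      go : ∀ b → b ≡ true → 1 + 𝟙 b ≡ 1 → ⊥
      go true _ ()

    arc-extendʳ : ∀ {P Q R a} → Z P Q R ≡ true → arc Z P Q a ≡ true → arc Z P R a ≡ true
    arc-extendʳ {P} {Q} {R} {a} f e with arc-split f a
    ... | s rewrite e = go (arc Z P R a) s
      where
      go : ∀ b → 𝟙 b ≡ 1 + 𝟙 (arc Z Q R a) → b ≡ true
      go true _ = refl
      go false ()

    arc-extendˡ : ∀ {P Q R a} → Z P Q R ≡ true → arc Z Q R a ≡ true → arc Z P R a ≡ true
    arc-extendˡ {P} {Q} {R} {a} f e with arc-split f a
    ... | s rewrite e | +-comm (𝟙 (arc Z P Q a)) 1 = go (arc Z P R a) s
      where
      go : ∀ b → 𝟙 b ≡ 1 + 𝟙 (arc Z P Q a) → b ≡ true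
      go true _ = refl
      go false ()

    arc-split-cases : ∀ {P Q R a} → Z P Q R ≡ true → arc Z P R a ≡ true → (arc Z P Q a ≡ true) ⊎ (arc Z Q R a ≡ true)
    arc-split-cases {P} {Q} {R} {a} f e with arc-split f a
    ... | s rewrite e with arc Z P Q a | arc Z Q R a
    ...   | true | _ = inj₁ refl
    ...   | false | true = inj₂ refl
    ...   | false | false with s
    ...     | ()

    arc-∧-subarc : ∀ {P Q R a} → Z P Q R ≡ true → (arc Z P R a ∧ arc Z P Q a) ≡ arc Z P Q a
    arc-∧-subarc f = ⇔⇒≡ (λ e → ∧-elimʳ (arc Z _ _ _) e) (λ e → ∧-intro (arc-extendʳ f e) e)

    arc-∧-subarc′ : ∀ {P Q R a} → Z P Q R ≡ true → (arc Z P Q a ∧ arc Z P R a) ≡ arc Z P Q a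
    arc-∧-subarc′ {P} {Q} {R} {a} f = ⇔⇒≡ (λ e → ∧-elimˡ (arc Z P Q a) e) (λ e → ∧-intro e (arc-extendʳ f e))

    positionCount : Fin m → Fin m → ℕ → ℕ
    positionCount X Y s = count (λ a → arc Z X Y a ∧ (position Z X a ≡ᵇ s)) (allFin m)

    -- The c + 1 points of the arc [X, Y) have pairwise distinct positions in {0, …, c},
    -- where c = content′ Z X Y; so by pigeonhole every position is taken exactly once.
    positionCount≡1 : ∀ {X Y} s → s ≤ content′ Z X Y → positionCount X Y s ≡ 1
    positionCount≡1 {X} {Y} s s≤c = sumBelow≡N⇒all-one (suc c) (positionCount X Y) at-most-one total-count s (s≤s s≤c)
      where
      c : ℕ
      c = content′ Z X Y
      at-most-one : ∀ s → positionCount X Y s ≤ 1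
      at-most-one s = count≤1 (λ a → arc Z X Y a ∧ (position Z X a ≡ᵇ s)) (λ a b e f →
         position-injective (∧-elimˡ (arc Z X Y a) e) (∧-elimˡ (arc Z X Y b) f)
           (trans (≡ᵇ⇒≡ (∧-elimʳ (arc Z X Y a) e)) (sym (≡ᵇ⇒≡ (∧-elimʳ (arc Z X Y b) f)))))
      one-position : ∀ a → sumBelow (suc c) (λ s → 𝟙 (arc Z X Y a ∧ (position Z X a ≡ᵇ s))) ≡ 𝟙 (arc Z X Y a)
      one-position a with arc Z X Y a in ea
      ... | true = trans (sumBelow-single (suc c) (position Z X a ≡ᵇ_) (position Z X a) (λ s e → sym (≡ᵇ⇒≡ e))
                           (s≤s (position≤content′ ea)))
                         (cong 𝟙 (≡ᵇ-refl (position Z X a)))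
      ... | false = sumBelow-zero (suc c)
      total-count : sumBelow (suc c) (positionCount X Y) ≡ suc c
      total-count = trans (sym (sumMap-sumBelow (suc c) (λ a s → 𝟙 (arc Z X Y a ∧ (position Z X a ≡ᵇ s))) (allFin m)))
                          (trans (sumMap-cong (allFin m) one-position) arc-size)
module Insertion where

  open import Defs
  open Booleans
  open Counting
  open Sums
  open import Data.Bool.Properties using (¬-not; not-¬)
  open CyclicOrder
  open import Data.Bool using (Bool; true; false; _∧_; _∨_; not)
  open import Data.Nat using (ℕ; zero; suc; _+_)
  open import Data.Fin using (Fin; zero; suc; fromℕ; inject₁; _≟_)
  open import Data.Maybe using (Maybe; just; nothing)
  import Data.Maybe
  open import Data.Maybe.Properties using (just-injective)
  open import Data.Product using (_×_; _,_; proj₁; proj₂; Σ)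
  open import Data.Sum using (_⊎_; inj₁; inj₂)
  open import Data.Empty using (⊥; ⊥-elim)
  open import Relation.Nullary using (¬_; yes; no)
  open import Relation.Nullary.Decidable using (⌊_⌋; toSum)
  open import Relation.Binary.PropositionalEquality
  open import Function using (_∘_)
  import Data.Fin.Properties
  import Data.Nat.Properties
  open import Data.List using (allFin)

  unlast : ∀ {m} → Fin (suc m) → Maybe (Fin m)
  unlast {zero} zero = nothing
  unlast {suc m} zero = just zero
  unlast {suc m} (suc x) = Data.Maybe.map suc (unlast x)

  unlast-inject₁ : ∀ {m} (x : Fin m) → unlast (inject₁ x) ≡ just x
  unlast-inject₁ {suc m} zero = refl
  unlast-inject₁ {suc m} (suc x) rewrite unlast-inject₁ x = refl

  unlast-fromℕ : ∀ m → unlast (fromℕ m) ≡ nothing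
  unlast-fromℕ zero = refl
  unlast-fromℕ (suc m) rewrite unlast-fromℕ m = refl

  unlast≡just : ∀ {m} (x : Fin (suc m)) {y : Fin m} → unlast x ≡ just y → x ≡ inject₁ y
  unlast≡just {suc m} zero refl = refl
  unlast≡just {suc m} (suc x) e with unlast x in ex
  unlast≡just {suc m} (suc x) refl | just y' = cong suc (unlast≡just x ex)

  unlast≡nothing : ∀ {m} (x : Fin (suc m)) → unlast x ≡ nothing → x ≡ fromℕ m
  unlast≡nothing {zero} zero e = refl
  unlast≡nothing {suc m} (suc x) e with unlast x in ex
  unlast≡nothing {suc m} (suc x) refl | nothing = cong suc (unlast≡nothing x ex)

  unlast-injective : ∀ {m} {x y : Fin (suc m)} → unlast x ≡ unlast y → x ≡ y
  unlast-injective {m} {x} {y} e with unlast x in ex | unlast y in ey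
  ... | just a | just b rewrite unlast≡just x ex | unlast≡just y ey | just-injective e = refl
  ... | nothing | nothing rewrite unlast≡nothing x ex | unlast≡nothing y ey = refl
  unlast-injective {m} {x} {y} () | just a | nothing
  unlast-injective {m} {x} {y} () | nothing | just b

  IsCyclicOrder-pullback : ∀ {m} {A : Set} (W : A → A → A → Bool) (f : Fin m → A) → (∀ {x y} → f x ≡ f y → x ≡ y) →
    IsCyclicOrder W → IsCyclicOrder (λ x y z → W (f x) (f y) (f z))
  IsCyclicOrder-pullback W f inj C = record
    { dist = λ {x} {y} {z} e → let (a , b , c) = dist {f x} {f y} {f z} e in (λ q → a (cong f q)) , (λ q → b (cong f q)) , (λ q → c (cong f q))
    ; cyc = λ {x} {y} {z} → cyc {f x} {f y} {f z}
    ; asym = λ {x} {y} {z} → asym {f x} {f y} {f z}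
    ; trn = λ {x} {y} {z} {u} → trn {f x} {f y} {f z} {f u}
    ; total = λ {x} {y} {z} a b c → total {f x} {f y} {f z} (λ q → a (inj q)) (λ q → b (inj q)) (λ q → c (inj q)) }
    where open IsCyclicOrder C

  -- The new point m + 1 is placed immediately after a: it sees y before z iff a does,
  -- or z is a itself (which then comes last).
  newTriple : ∀ {m} → Triples m → Fin m → Fin m → Fin m → Bool
  newTriple Z a y z = Z a y z ∨ (⌊ z ≟ a ⌋ ∧ not ⌊ y ≟ a ⌋)

  -- nothing stands for the new point.
  insertAfter′ : ∀ {m} → Triples m → Fin m → Maybe (Fin m) → Maybe (Fin m) → Maybe (Fin m) → Bool
  insertAfter′ Z a (just x) (just y) (just z) = Z x y z
  insertAfter′ Z a nothing (just y) (just z) = newTriple Z a y z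
  insertAfter′ Z a (just x) nothing (just z) = newTriple Z a z x
  insertAfter′ Z a (just x) (just y) nothing = newTriple Z a x y
  insertAfter′ Z a _ _ _ = false

  insertAfter : ∀ {m} → Triples m → Fin m → Triples (suc m)
  insertAfter Z a x y z = insertAfter′ Z a (unlast x) (unlast y) (unlast z)

  restrict : ∀ {m} → Triples (suc m) → Triples m
  restrict Z x y z = Z (inject₁ x) (inject₁ y) (inject₁ z)

  module InsertAfter {m : ℕ} {Z : Triples m} (T : IsCyclicOrder Z) (a : Fin m) where
    open Geometry T

    newTriple-cases : ∀ {y z} → newTriple Z a y z ≡ true → (Z a y z ≡ true) ⊎ ((z ≡ a) × (¬ y ≡ a))
    newTriple-cases {y} {z} e with ∨-elim {Z a y z} e
    ... | inj₁ p = inj₁ p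
    ... | inj₂ q = inj₂ (⌊≟⌋-true⇒≡ (∧-elimˡ ⌊ z ≟ a ⌋ q) , ⌊≟⌋-false⇒≢ (not-elim (∧-elimʳ ⌊ z ≟ a ⌋ q)))

    newTriple-old : ∀ {y z} → Z a y z ≡ true → newTriple Z a y z ≡ true
    newTriple-old e = ∨-introˡ e
    newTriple-at : ∀ {y z} → z ≡ a → ¬ y ≡ a → newTriple Z a y z ≡ true
    newTriple-at {y} {z} p q = ∨-introʳ {Z a y z} (∧-intro (⌊≟⌋-true p) (not-intro (⌊≟⌋-false q)))

    newTriple-≢ : ∀ {y z} → newTriple Z a y z ≡ true → ¬ y ≡ z
    newTriple-≢ e with newTriple-cases e
    ... | inj₁ p = ≢₂₃ p
    ... | inj₂ (p , q) = λ r → q (trans r p)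

    newTriple-asym : ∀ {y z} → newTriple Z a y z ≡ true → newTriple Z a z y ≡ false
    newTriple-asym {y} {z} e = ¬-not λ f → go (newTriple-cases e) (newTriple-cases f)
      where
      go : (Z a y z ≡ true) ⊎ (z ≡ a × ¬ y ≡ a) → (Z a z y ≡ true) ⊎ (y ≡ a × ¬ z ≡ a) → ⊥
      go (inj₁ p) (inj₁ q) = asym-⊥ p (cyc q)
      go (inj₁ p) (inj₂ (q , _)) = ≢₁₂ p (sym q)
      go (inj₂ (p , _)) (inj₁ q) = ≢₁₂ q (sym p)
      go (inj₂ (p , q)) (inj₂ (r , s)) = q r

    newTriple-trans : ∀ {y z u} → newTriple Z a y z ≡ true → newTriple Z a z u ≡ true → newTriple Z a y u ≡ true
    newTriple-trans e f with newTriple-cases e | newTriple-cases f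
    ... | inj₁ p | inj₁ q = newTriple-old (trn p q)
    ... | inj₁ p | inj₂ (q , _) = newTriple-at q (λ r → ≢₁₂ p (sym r))
    ... | inj₂ (p , _) | inj₁ q = ⊥-elim (≢₁₂ q (sym p))
    ... | inj₂ (p , q) | inj₂ (_ , r) = ⊥-elim (r p)

    trans-new₂ : ∀ {x z u} → newTriple Z a z x ≡ true → Z x z u ≡ true → newTriple Z a u x ≡ true
    trans-new₂ {x} {z} {u} e f with newTriple-cases e
    ... | inj₂ (refl , q) = newTriple-at refl (λ r → ≢₁₃ f (sym r))
    ... | inj₁ p with toSum (a ≟ u)
    ...   | inj₁ refl = ⊥-elim (asym-⊥ p f)
    ...   | inj₂ nau with total {a} {u} {x} nau (≢₁₃ f ∘ sym) (≢₁₃ p)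
    ...     | inj₁ q = newTriple-old q
    ...     | inj₂ q = ⊥-elim (asym-⊥ p (trn f q))

    trans-new₃ : ∀ {x y u} → newTriple Z a x y ≡ true → newTriple Z a u x ≡ true → Z x y u ≡ true
    trans-new₃ e f with newTriple-cases e | newTriple-cases f
    ... | _ | inj₂ (refl , q) with newTriple-cases e
    ...   | inj₁ p = ⊥-elim (≢₁₂ p refl)
    ...   | inj₂ (_ , r) = ⊥-elim (r refl)
    trans-new₃ e f | inj₂ (refl , _) | inj₁ q = cyc² q
    trans-new₃ e f | inj₁ p | inj₁ q = trn (cyc p) (cyc² q)

    trans-new₄ : ∀ {x y z} → Z x y z ≡ true → newTriple Z a x z ≡ true → newTriple Z a x y ≡ true
    trans-new₄ {x} {y} {z} f e with newTriple-cases e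
    ... | inj₂ (refl , _) = newTriple-old (cyc² f)
    ... | inj₁ p with toSum (y ≟ a)
    ...   | inj₁ refl = newTriple-at refl (≢₁₂ f)
    ...   | inj₂ nya = newTriple-old (cyc² (trn f (cyc p)))

    newTriple-total : ∀ {y z} → ¬ y ≡ z → (newTriple Z a y z ≡ true) ⊎ (newTriple Z a z y ≡ true)
    newTriple-total {y} {z} n with toSum (y ≟ a) | toSum (z ≟ a)
    ... | inj₁ refl | _ = inj₂ (newTriple-at refl (λ q → n (sym q)))
    ... | inj₂ nya | inj₁ refl = inj₁ (newTriple-at refl nya)
    ... | inj₂ nya | inj₂ nza with total {a} {y} {z} (nya ∘ sym) n (nza ∘ sym)
    ...   | inj₁ p = inj₁ (newTriple-old p)
    ...   | inj₂ p = inj₂ (newTriple-old (cyc² p))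

    private
      just-≢ : ∀ {x y : Fin m} → ¬ x ≡ y → ¬ just x ≡ just y
      just-≢ x≢y = x≢y ∘ just-injective

    W : Maybe (Fin m) → Maybe (Fin m) → Maybe (Fin m) → Bool
    W = insertAfter′ Z a

    Wdist : ∀ {x y z} → W x y z ≡ true → (¬ x ≡ y) × (¬ y ≡ z) × (¬ x ≡ z)
    Wdist {just x} {just y} {just z} e = let (p , q , r) = dist e in just-≢ p , just-≢ q , just-≢ r
    Wdist {nothing} {just y} {just z} e = (λ ()) , just-≢ (newTriple-≢ e) , (λ ())
    Wdist {just x} {nothing} {just z} e = (λ ()) , (λ ()) , just-≢ (λ q → newTriple-≢ e (sym q))
    Wdist {just x} {just y} {nothing} e = just-≢ (newTriple-≢ e) , (λ ()) , (λ ())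

    Wcyc : ∀ {x y z} → W x y z ≡ true → W y z x ≡ true
    Wcyc {just x} {just y} {just z} e = cyc e
    Wcyc {nothing} {just y} {just z} e = e
    Wcyc {just x} {nothing} {just z} e = e
    Wcyc {just x} {just y} {nothing} e = e

    Wasym : ∀ {x y z} → W x y z ≡ true → W z y x ≡ false
    Wasym {just x} {just y} {just z} e = asym e
    Wasym {nothing} {just y} {just z} e = newTriple-asym e
    Wasym {just x} {nothing} {just z} e = newTriple-asym e
    Wasym {just x} {just y} {nothing} e = newTriple-asym e

    Wtrn : ∀ {x y z u} → W x y z ≡ true → W x z u ≡ true → W x y u ≡ true
    Wtrn {just x} {just y} {just z} {just u} e f = trn e f
    Wtrn {nothing} {just y} {just z} {just u} e f = newTriple-trans e f
    Wtrn {just x} {nothing} {just z} {just u} e f = trans-new₂ e f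
    Wtrn {just x} {just y} {nothing} {just u} e f = trans-new₃ e f
    Wtrn {just x} {just y} {just z} {nothing} e f = trans-new₄ e f
    Wtrn {just x} {nothing} {just z} {nothing} e f = ⊥-elim (not-¬ f (newTriple-asym e))
    Wtrn {nothing} {nothing} {_} {_} () f
    Wtrn {nothing} {just y} {nothing} {_} () f
    Wtrn {nothing} {just y} {just z} {nothing} e ()
    Wtrn {just x} {nothing} {nothing} {_} () f
    Wtrn {just x} {just y} {nothing} {nothing} e ()

    Wtotal : ∀ {x y z} → ¬ x ≡ y → ¬ y ≡ z → ¬ x ≡ z → (W x y z ≡ true) ⊎ (W z y x ≡ true)
    Wtotal {just x} {just y} {just z} p q r = total (λ s → p (cong just s)) (λ s → q (cong just s)) (λ s → r (cong just s))
    Wtotal {nothing} {just y} {just z} p q r = newTriple-total (λ s → q (cong just s))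
    Wtotal {just x} {nothing} {just z} p q r = Data.Sum.swap (newTriple-total (λ s → r (cong just s)))
    Wtotal {just x} {just y} {nothing} p q r = newTriple-total (λ s → p (cong just s))
    Wtotal {nothing} {nothing} p q r = ⊥-elim (p refl)
    Wtotal {nothing} {just y} {nothing} p q r = ⊥-elim (r refl)
    Wtotal {just x} {nothing} {nothing} p q r = ⊥-elim (q refl)

    isCyclicOrder : IsCyclicOrder W
    isCyclicOrder = record { dist = λ {x} {y} {z} → Wdist {x} {y} {z} ; cyc = λ {x} {y} {z} → Wcyc {x} {y} {z}
                  ; asym = λ {x} {y} {z} → Wasym {x} {y} {z} ; trn = λ {x} {y} {z} {u} → Wtrn {x} {y} {z} {u}
                  ; total = λ {x} {y} {z} → Wtotal {x} {y} {z} }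

  insertAfter-isCyclicOrder : ∀ {m} {Z : Triples m} → IsCyclicOrder Z → (a : Fin m) → IsCyclicOrder (insertAfter Z a)
  insertAfter-isCyclicOrder T a = IsCyclicOrder-pullback (insertAfter′ _ a) unlast unlast-injective (InsertAfter.isCyclicOrder T a)

  restrict-isCyclicOrder : ∀ {m} {Z : Triples (suc m)} → IsCyclicOrder Z → IsCyclicOrder (restrict Z)
  restrict-isCyclicOrder {Z = Z} T = IsCyclicOrder-pullback Z inject₁ Data.Fin.Properties.inject₁-injective T

  restrict-insertAfter : ∀ {m} (Z : Triples m) (a : Fin m) x y z → restrict (insertAfter Z a) x y z ≡ Z x y z
  restrict-insertAfter Z a x y z rewrite unlast-inject₁ x | unlast-inject₁ y | unlast-inject₁ z = refl

  inject₁≢fromℕ : ∀ {m} (x : Fin m) → ¬ inject₁ x ≡ fromℕ m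
  inject₁≢fromℕ x e = Data.Fin.Properties.fromℕ≢inject₁ (sym e)

  firstWhere : ∀ {k} → (Fin k → Bool) → Maybe (Fin k)
  firstWhere {zero} p = nothing
  firstWhere {suc k} p with p zero
  ... | true = just zero
  ... | false = Data.Maybe.map suc (firstWhere (p ∘ suc))

  firstWhere-some : ∀ {k} (p : Fin k → Bool) (a : Fin k) → p a ≡ true → Σ (Fin k) λ b → (firstWhere p ≡ just b) × (p b ≡ true)
  firstWhere-some {suc k} p a e with p zero in p0
  ... | true = zero , refl , p0
  firstWhere-some {suc k} p zero e | false = ⊥-elim (not-¬ e p0)
  firstWhere-some {suc k} p (suc a) e | false with firstWhere-some (p ∘ suc) a e
  ... | b , fe , pb rewrite fe = suc b , refl , pb

  firstWhere-cong : ∀ {k} (p q : Fin k → Bool) → (∀ x → p x ≡ q x) → firstWhere p ≡ firstWhere q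
  firstWhere-cong {zero} p q h = refl
  firstWhere-cong {suc k} p q h rewrite h zero with q zero
  ... | true = refl
  ... | false = cong (Data.Maybe.map suc) (firstWhere-cong (p ∘ suc) (q ∘ suc) (h ∘ suc))

  IsPredᵇ : ∀ {k} → Triples (suc (suc k)) → Fin (suc k) → Bool
  IsPredᵇ {k} Z a = ∀ᵇ λ y → not (Z (inject₁ a) (inject₁ y) (fromℕ (suc k)))

  -- The default zero is never used for a cyclic order (see predOfLast-IsPred).
  predOfLast : ∀ {k} → Triples (suc (suc k)) → Fin (suc k)
  predOfLast Z = Data.Maybe.fromMaybe zero (firstWhere (IsPredᵇ Z))

  predOfLast-cong : ∀ {k} (Z1 Z2 : Triples (suc (suc k))) → (∀ x y z → Z1 x y z ≡ Z2 x y z) → predOfLast Z1 ≡ predOfLast Z2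
  predOfLast-cong {k} Z1 Z2 h = cong (Data.Maybe.fromMaybe zero) (firstWhere-cong (IsPredᵇ Z1) (IsPredᵇ Z2)
     (λ a → ∀ᵇ-cong (λ y → not (Z1 (inject₁ a) (inject₁ y) (fromℕ (suc k)))) (λ y → not (Z2 (inject₁ a) (inject₁ y) (fromℕ (suc k))))
        (λ y → cong not (h (inject₁ a) (inject₁ y) (fromℕ (suc k))))))

  module Predecessor {k : ℕ} {Z : Triples (suc (suc k))} (T : IsCyclicOrder Z) where
    open Geometry T
    private
      m : ℕ
      m = suc k
      N : Fin (suc m)
      N = fromℕ m
      i : Fin m → Fin (suc m)
      i = inject₁

    IsPred : Fin m → Set
    IsPred a = ∀ y → Z (i a) (i y) N ≡ false

    IsPred⇒IsPredᵇ : ∀ a → IsPred a → IsPredᵇ Z a ≡ true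
    IsPred⇒IsPredᵇ a h = ∀ᵇ-intro (λ y → not (Z (i a) (i y) N)) (λ y → not-intro (h y))
    IsPredᵇ⇒IsPred : ∀ a → IsPredᵇ Z a ≡ true → IsPred a
    IsPredᵇ⇒IsPred a e y = not-elim (∀ᵇ-elim (λ y → not (Z (i a) (i y) N)) e y)

    inject₁-≢ : ∀ {a b : Fin m} → ¬ a ≡ b → ¬ i a ≡ i b
    inject₁-≢ n e = n (Data.Fin.Properties.inject₁-injective e)

    IsPred-unique : ∀ {a b} → IsPred a → IsPred b → a ≡ b
    IsPred-unique {a} {b} ha hb with a ≟ b
    ... | yes p = p
    ... | no n with total {i a} {i b} {N} (inject₁-≢ n) (inject₁≢fromℕ b) (inject₁≢fromℕ a)
    ...   | inj₁ e = ⊥-elim (not-¬ e (ha b))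
    ...   | inj₂ e = ⊥-elim (not-¬ (cyc e) (hb a))

    afterCount : Fin m → ℕ
    afterCount a = count (λ y → Z (i a) (i y) N) (allFin m)

    -- If some y lies strictly between a and the last point, then fewer points lie between y
    -- and the last point; so this descent ends at the predecessor.
    IsPred-search : ∀ n a → Data.Nat._≤_ (afterCount a) n → Σ (Fin m) IsPred
    IsPred-search n a le with afterCount a Data.Nat.≟ 0
    ... | yes e = a , count≡0⇒none (λ y → Z (i a) (i y) N) e
    ... | no nonzero with count≢0⇒some (λ y → Z (i a) (i y) N) nonzero
    ...   | y , zy with n
    ...     | zero = ⊥-elim (nonzero (Data.Nat.Properties.n≤0⇒n≡0 le))
    ...     | suc n' = IsPred-search n' y (Data.Nat.Properties.≤-pred (Data.Nat.Properties.≤-trans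
                 (count-< (λ y' → Z (i y) (i y') N) (λ y' → Z (i a) (i y') N)
                    (λ y' e → cyc (trn (cyc² zy) (cyc² e))) y zy (¬-not (λ e → ≢₁₂ e refl))) le))

    IsPred-exists : Σ (Fin m) IsPred
    IsPred-exists = IsPred-search (afterCount zero) zero Data.Nat.Properties.≤-refl

    predOfLast-IsPred : IsPred (predOfLast Z)
    predOfLast-IsPred with firstWhere-some (IsPredᵇ Z) (proj₁ IsPred-exists) (IsPred⇒IsPredᵇ _ (proj₂ IsPred-exists))
    ... | b , fe , pb rewrite fe = IsPredᵇ⇒IsPred b pb

    predOfLast-unique : ∀ a → IsPred a → predOfLast Z ≡ a
    predOfLast-unique a h = IsPred-unique predOfLast-IsPred h

    N-y-pred : ∀ {a y} → IsPred a → ¬ y ≡ a → Z N (i y) (i a) ≡ true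
    N-y-pred {a} {y} h n with total {N} {i y} {i a} (λ e → inject₁≢fromℕ y (sym e)) (inject₁-≢ n) (λ e → inject₁≢fromℕ a (sym e))
    ... | inj₁ e = e
    ... | inj₂ e = ⊥-elim (not-¬ e (h y))

    ¬N-pred-y : ∀ {a} y → IsPred a → Z N (i a) (i y) ≡ false
    ¬N-pred-y {a} y h = ¬-not (λ e → not-¬ (cyc e) (h y))

    module NR (a : Fin m) = InsertAfter (restrict-isCyclicOrder T) a

    pred-y-z⇒N-y-z : ∀ {a y z} → IsPred a → Z (i a) (i y) (i z) ≡ true → Z N (i y) (i z) ≡ true
    pred-y-z⇒N-y-z {a} {y} {z} h e with total {N} {i y} {i z} (λ q → inject₁≢fromℕ y (sym q)) (≢₂₃ e) (λ q → inject₁≢fromℕ z (sym q))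
    ... | inj₁ w = w
    ... | inj₂ w = ⊥-elim (not-¬ (cyc² (trn (cyc w) (cyc e))) (h y))

    N-y-z⇒pred-y-z : ∀ {a y z} → IsPred a → ¬ z ≡ a → Z N (i y) (i z) ≡ true → Z (i a) (i y) (i z) ≡ true
    N-y-z⇒pred-y-z {a} {y} {z} h nz e with toSum (y ≟ a)
    ... | inj₁ refl = ⊥-elim (not-¬ e (¬N-pred-y z h))
    ... | inj₂ ny with total {i a} {i y} {i z} (inject₁-≢ (λ q → ny (sym q))) (≢₂₃ e) (inject₁-≢ (λ q → nz (sym q)))
    ...   | inj₁ w = w
    ...   | inj₂ w = ⊥-elim (asym-⊥ w (cyc (trn (cyc (N-y-pred h nz)) (cyc² e))))

    newTriple-restrict : ∀ {a} → IsPred a → ∀ y z → newTriple (restrict Z) a y z ≡ Z N (i y) (i z)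
    newTriple-restrict {a} h y z = ⇔⇒≡ to from
      where
      to : newTriple (restrict Z) a y z ≡ true → Z N (i y) (i z) ≡ true
      to e with NR.newTriple-cases a e
      ... | inj₂ (refl , ny) = N-y-pred h ny
      ... | inj₁ p = pred-y-z⇒N-y-z h p
      from : Z N (i y) (i z) ≡ true → newTriple (restrict Z) a y z ≡ true
      from e with toSum (z ≟ a)
      ... | inj₁ refl = NR.newTriple-at a refl (λ q → not-¬ e (subst (λ w → Z N (i w) (i z) ≡ false) (sym q) (¬N-pred-y z h)))
      ... | inj₂ nz = NR.newTriple-old a (N-y-z⇒pred-y-z h nz e)

    insertAfter-restrict : ∀ {a} → IsPred a → ∀ x y z → insertAfter (restrict Z) a x y z ≡ Z x y z
    insertAfter-restrict {a} h x y z with unlast x in ex | unlast y in ey | unlast z in ez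
    ... | just x' | just y' | just z' rewrite unlast≡just x ex | unlast≡just y ey | unlast≡just z ez = refl
    ... | nothing | just y' | just z' rewrite unlast≡nothing x ex | unlast≡just y ey | unlast≡just z ez = newTriple-restrict h y' z'
    ... | just x' | nothing | just z' rewrite unlast≡just x ex | unlast≡nothing y ey | unlast≡just z ez =
          trans (newTriple-restrict h z' x') (trans (cyc-≡ N (i z') (i x')) (cyc-≡ (i z') (i x') N))
    ... | just x' | just y' | nothing rewrite unlast≡just x ex | unlast≡just y ey | unlast≡nothing z ez =
          trans (newTriple-restrict h x' y') (cyc-≡ N (i x') (i y'))
    ... | nothing | nothing | z' rewrite unlast≡nothing x ex | unlast≡nothing y ey = sym (¬-not (λ e → ≢₁₂ e refl))
    ... | nothing | just y' | nothing rewrite unlast≡nothing x ex | unlast≡nothing z ez = sym (¬-not (λ e → ≢₁₃ e refl))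
    ... | just x' | nothing | nothing rewrite unlast≡nothing y ey | unlast≡nothing z ez = sym (¬-not (λ e → ≢₂₃ e refl))

  predOfLast-insertAfter : ∀ {k} {Z : Triples (suc k)} → IsCyclicOrder Z → (a : Fin (suc k)) → predOfLast (insertAfter Z a) ≡ a
  predOfLast-insertAfter {k} {Z} T a = Predecessor.predOfLast-unique (insertAfter-isCyclicOrder T a) a h
    where
    h : ∀ y → insertAfter Z a (inject₁ a) (inject₁ y) (fromℕ (suc k)) ≡ false
    h y rewrite unlast-inject₁ a | unlast-inject₁ y | unlast-fromℕ (suc k) = ¬-not go
      where
      go : newTriple Z a a y ≡ true → ⊥
      go e with InsertAfter.newTriple-cases T a e
      ... | inj₁ p = Geometry.≢₁₂ T p refl
      ... | inj₂ (_ , q) = q refl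

  insertAfter-old-new-old : ∀ {m} (Z : Triples m) a (u v : Fin m) → insertAfter Z a (inject₁ u) (fromℕ m) (inject₁ v) ≡ newTriple Z a v u
  insertAfter-old-new-old {m} Z a u v rewrite unlast-inject₁ u | unlast-inject₁ v | unlast-fromℕ m = refl


module Decomposition where

  open import Defs
  open Booleans
  open Counting
  open InjectiveCounting
  open CyclicOrder
  open Insertion
  open import Data.Bool using (Bool; true; false; _∧_; _∨_)
  import Data.Bool.Properties as BP
  open import Data.Nat using (ℕ; suc)
  open import Data.Nat.Properties using (≤-antisym)
  open import Data.Fin using (Fin; inject₁; _≟_)
  open import Data.Maybe using (just; nothing)
  open import Data.List using (List; []; _∷_; map; concatMap; allFin)
  open import Data.List.Relation.Unary.Any using (here; there)
  open import Data.List.Relation.Unary.All using ([]; _∷_)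
  open import Data.List.Relation.Unary.AllPairs using ([]; _∷_)
  import Data.List.Relation.Unary.Unique.Propositional.Properties as Unique
  import Data.List.Membership.Propositional.Properties as Membership
  open import Data.Product using (_×_; _,_)
  open import Data.Product.Relation.Binary.Pointwise.NonDependent using (×-isEquivalence; ×-decidable)
    renaming (Pointwise to ×-Pointwise)
  import Data.Sum as Sum
  open import Data.Vec.Functional.Relation.Binary.Pointwise using (Pointwise)
  import Data.Vec.Functional.Relation.Binary.Pointwise.Properties as PW
  open import Relation.Binary.Structures using (IsEquivalence)
  open import Relation.Nullary using (Dec)
  open import Relation.Binary.PropositionalEquality
  open import Function using (_∘_)

  SameTriples : (m : ℕ) → Triples m → Triples m → Set
  SameTriples m = Pointwise (Pointwise (Pointwise _≡_ {m}) {m}) {m}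

  SameTriples-equiv : (m : ℕ) → IsEquivalence (SameTriples m)
  SameTriples-equiv m = PW.isEquivalence (PW.isEquivalence (PW.isEquivalence isEquivalence m) m) m

  SameTriples-dec : (m : ℕ) → ∀ Z₁ Z₂ → Dec (SameTriples m Z₁ Z₂)
  SameTriples-dec m = PW.decidable (PW.decidable (PW.decidable BP._≟_))

  bools-distinct : DistinctUpTo {Bool} _≡_ (true ∷ false ∷ [])
  bools-distinct = ((λ ()) ∷ []) ∷ ([] ∷ [])

  bools-complete : CompleteUpTo {Bool} _≡_ (true ∷ false ∷ [])
  bools-complete true = here refl
  bools-complete false = there (here refl)

  allTriples-distinct : (m : ℕ) → DistinctUpTo (SameTriples m) (allTriples m)
  allTriples-distinct m = allFuns-distinct _ (allFuns-distinct _ (allFuns-distinct _ bools-distinct m) m) m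

  allTriples-complete : (m : ℕ) → CompleteUpTo (SameTriples m) (allTriples m)
  allTriples-complete m =
    allFuns-complete (PW.isEquivalence (PW.isEquivalence isEquivalence m) m) _
      (allFuns-complete (PW.isEquivalence isEquivalence m) _ (allFuns-complete isEquivalence _ bools-complete m) m) m

  pointedTriples : (m : ℕ) → List (Triples m × Fin m)
  pointedTriples m = concatMap (λ Z → map (λ a → (Z , a)) (allFin m)) (allTriples m)

  SamePointed : (m : ℕ) → Triples m × Fin m → Triples m × Fin m → Set
  SamePointed m = ×-Pointwise (SameTriples m) _≡_

  SamePointed-equiv : (m : ℕ) → IsEquivalence (SamePointed m)
  SamePointed-equiv m = ×-isEquivalence (SameTriples-equiv m) isEquivalence

  pointedTriples-distinct : (m : ℕ) → DistinctUpTo (SamePointed m) (pointedTriples m)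
  pointedTriples-distinct m =
    pairs-distinct {RA = SameTriples m} {RB = _≡_} _,_ (λ e → e) (allTriples m) (allTriples-distinct m) (allFin m) (Unique.allFin⁺ m)

  pointedTriples-complete : (m : ℕ) → CompleteUpTo (SamePointed m) (pointedTriples m)
  pointedTriples-complete m =
    pairs-complete {RA = SameTriples m} {RB = _≡_} _,_ (λ { (Z , a) → Z , a , IsEquivalence.refl (SamePointed-equiv m) })
      _,_ (IsEquivalence.trans (SamePointed-equiv m)) (allTriples m) (allTriples-complete m) (allFin m) Membership.∈-allFin

  IsCyclicOrder-resp : ∀ {m} {Z₁ Z₂ : Triples m} → SameTriples m Z₁ Z₂ → IsCyclicOrder Z₁ → IsCyclicOrder Z₂
  IsCyclicOrder-resp {m} {Z₁} {Z₂} h T = record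
    { dist = λ {x} {y} {z} e → dist (trans (h x y z) e)
    ; cyc = λ {x} {y} {z} e → trans (sym (h y z x)) (cyc (trans (h x y z) e))
    ; asym = λ {x} {y} {z} e → trans (sym (h z y x)) (asym (trans (h x y z) e))
    ; trn = λ {x} {y} {z} {u} e f → trans (sym (h x y u)) (trn (trans (h x y z) e) (trans (h x z u) f))
    ; total = λ {x} {y} {z} a b c → Sum.map (trans (sym (h x y z))) (trans (sym (h z y x))) (total a b c)
    }
    where open IsCyclicOrder T

  isTotalCyclicOrder-cong : ∀ {m} {Z₁ Z₂ : Triples m} → SameTriples m Z₁ Z₂ → isTotalCyclicOrder Z₁ ≡ isTotalCyclicOrder Z₂
  isTotalCyclicOrder-cong {m} {Z₁} {Z₂} h =
    ⇔⇒≡ (λ e → IsCyclicOrder⇒isTotalCyclicOrder Z₂ (IsCyclicOrder-resp h (isTotalCyclicOrder⇒IsCyclicOrder Z₁ e)))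
        (λ e → IsCyclicOrder⇒isTotalCyclicOrder Z₁ (IsCyclicOrder-resp (IsEquivalence.sym (SameTriples-equiv m) h)
                                                                        (isTotalCyclicOrder⇒IsCyclicOrder Z₂ e)))

  insertAfter-cong : ∀ {m} {Z₁ Z₂ : Triples m} → SameTriples m Z₁ Z₂ → ∀ a → SameTriples (suc m) (insertAfter Z₁ a) (insertAfter Z₂ a)
  insertAfter-cong {m} {Z₁} {Z₂} h a x y z = go (unlast x) (unlast y) (unlast z)
    where
    new : ∀ y z → newTriple Z₁ a y z ≡ newTriple Z₂ a y z
    new y z = cong (_∨ _) (h a y z)
    go : ∀ u v w → insertAfter′ Z₁ a u v w ≡ insertAfter′ Z₂ a u v w
    go (just x) (just y) (just z) = h x y z
    go nothing (just y) (just z) = new y z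
    go (just x) nothing (just z) = new z x
    go (just x) (just y) nothing = new x y
    go nothing nothing w = refl
    go nothing (just y) nothing = refl
    go (just x) nothing nothing = refl

  -- split and join are injective on orders (up to SameTriples) in both directions,
  -- so counting by injection each way gives equality.
  module _ (k : ℕ) (P : Triples (suc (suc k)) → Bool)
           (P-cong : ∀ {Z₁ Z₂} → SameTriples (suc (suc k)) Z₁ Z₂ → P Z₁ ≡ P Z₂) where
    private
      m : ℕ
      m = suc k

      p : Triples (suc m) → Bool
      p Z = isTotalCyclicOrder Z ∧ P Z

      q : Triples m × Fin m → Bool
      q (Z , a) = isTotalCyclicOrder Z ∧ P (insertAfter Z a)

      p-resp : ∀ {Z₁ Z₂} → SameTriples (suc m) Z₁ Z₂ → p Z₁ ≡ true → p Z₂ ≡ true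
      p-resp h = trans (sym (cong₂ _∧_ (isTotalCyclicOrder-cong h) (P-cong h)))

      q-resp : ∀ {x y} → SamePointed m x y → q x ≡ true → q y ≡ true
      q-resp {Z₁ , a} (h , refl) = trans (sym (cong₂ _∧_ (isTotalCyclicOrder-cong h) (P-cong (insertAfter-cong h a))))

      order : ∀ {n} (Z : Triples n) {b} → (isTotalCyclicOrder Z ∧ b) ≡ true → IsCyclicOrder Z
      order Z e = isTotalCyclicOrder⇒IsCyclicOrder Z (∧-elimˡ (isTotalCyclicOrder Z) e)

      reinsert : ∀ Z → IsCyclicOrder Z → SameTriples (suc m) (insertAfter (restrict Z) (predOfLast Z)) Z
      reinsert Z T = Predecessor.insertAfter-restrict T (Predecessor.predOfLast-IsPred T)

      split : Triples (suc m) → Triples m × Fin m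
      split Z = restrict Z , predOfLast Z

      join : Triples m × Fin m → Triples (suc m)
      join (Z , a) = insertAfter Z a

      split-preserves : ∀ Z → p Z ≡ true → q (split Z) ≡ true
      split-preserves Z e =
        ∧-intro (IsCyclicOrder⇒isTotalCyclicOrder (restrict Z) (restrict-isCyclicOrder (order Z e)))
                (trans (P-cong (reinsert Z (order Z e))) (∧-elimʳ (isTotalCyclicOrder Z) e))

      split-injective : ∀ Z₁ Z₂ → p Z₁ ≡ true → p Z₂ ≡ true → SamePointed m (split Z₁) (split Z₂) → SameTriples (suc m) Z₁ Z₂
      split-injective Z₁ Z₂ e₁ e₂ (h , same-pred) =
        S-trans (S-sym (reinsert Z₁ (order Z₁ e₁))) (S-trans reinsert-same (reinsert Z₂ (order Z₂ e₂)))
        where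
        open IsEquivalence (SameTriples-equiv (suc m)) renaming (sym to S-sym; trans to S-trans)
        reinsert-same : SameTriples (suc m) (insertAfter (restrict Z₁) (predOfLast Z₁)) (insertAfter (restrict Z₂) (predOfLast Z₂))
        reinsert-same = subst (λ b → SameTriples (suc m) (insertAfter (restrict Z₁) (predOfLast Z₁)) (insertAfter (restrict Z₂) b))
                              same-pred (insertAfter-cong h (predOfLast Z₁))

      join-preserves : ∀ x → q x ≡ true → p (join x) ≡ true
      join-preserves (Z , a) e =
        ∧-intro (IsCyclicOrder⇒isTotalCyclicOrder (insertAfter Z a) (insertAfter-isCyclicOrder (order Z e) a))
                (∧-elimʳ (isTotalCyclicOrder Z) e)

      join-injective : ∀ x y → q x ≡ true → q y ≡ true → SameTriples (suc m) (join x) (join y) → SamePointed m x y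
      join-injective (Z₁ , a₁) (Z₂ , a₂) e₁ e₂ h =
        (λ x y z → trans (sym (restrict-insertAfter Z₁ a₁ x y z)) (trans (h (inject₁ x) (inject₁ y) (inject₁ z)) (restrict-insertAfter Z₂ a₂ x y z))) ,
        trans (sym (predOfLast-insertAfter (order Z₁ e₁) a₁))
              (trans (predOfLast-cong (insertAfter Z₁ a₁) (insertAfter Z₂ a₂) h) (predOfLast-insertAfter (order Z₂ e₂) a₂))

    count-insertions : count (λ Z → isTotalCyclicOrder Z ∧ P Z) (allTriples (suc m)) ≡
                       sumMap (λ Z → count (λ a → isTotalCyclicOrder Z ∧ P (insertAfter Z a)) (allFin m)) (allTriples m)
    count-insertions = trans
      (≤-antisym
        (count≤count-of-injection (SamePointed-equiv m) (×-decidable (SameTriples-dec m) _≟_) p q q-resp split split-preserves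
           split-injective (allTriples (suc m)) (allTriples-distinct (suc m)) (pointedTriples m) (pointedTriples-complete m))
        (count≤count-of-injection (SameTriples-equiv (suc m)) (SameTriples-dec (suc m)) q p p-resp join join-preserves
           join-injective (pointedTriples m) (pointedTriples-distinct m) (allTriples (suc m)) (allTriples-complete (suc m))))
      (trans (sumMap-concatMap (𝟙 ∘ q) (λ Z → map (λ a → (Z , a)) (allFin m)) (allTriples m))
             (sumMap-cong (allTriples m) (λ Z → sumMap-map (𝟙 ∘ q) (λ a → (Z , a)) (allFin m))))

module WordCondition where

  open import Defs
  open Booleans
  open Counting
  open CyclicOrder
  open Insertion
  open Decomposition using (SameTriples)
  open import Data.Bool using (Bool; true; _∧_)
  open import Data.Nat using (zero; suc)
  open import Data.Fin using (Fin; zero; suc; fromℕ; inject₁)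
  open import Data.Vec using (Vec; _∷_; []; lookup; _∷ʳ_)
  open import Data.Maybe using (just; nothing)
  open import Data.Product using (_,_; proj₁; Σ)
  open import Relation.Binary.PropositionalEquality
  open import Function using (_∘_)

  -- The letter test of respectsWord is local to its where-clause; this gives it a name.
  respectsWord-∀ᵇ : ∀ {n} (w : Vec Sign n) (Z : Triples (suc (suc n))) → Σ (Fin n → Bool) λ p → respectsWord w Z ≡ ∀ᵇ p
  respectsWord-∀ᵇ w Z = _ , refl

  respectsWordAt : ∀ {n} → Vec Sign n → Triples (suc (suc n)) → Fin n → Bool
  respectsWordAt w Z = proj₁ (respectsWord-∀ᵇ w Z)

  letterHolds : ∀ {n} → Triples (suc (suc n)) → Sign → Fin n → Bool
  letterHolds Z plus i = Z (inject₁ (inject₁ i)) (suc (inject₁ i)) (suc (suc i))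
  letterHolds Z minus i = Z (suc (suc i)) (suc (inject₁ i)) (inject₁ (inject₁ i))

  respectsWordAt≡letterHolds : ∀ {n} (w : Vec Sign n) Z (i : Fin n) → respectsWordAt w Z i ≡ letterHolds Z (lookup w i) i
  respectsWordAt≡letterHolds w Z i with lookup w i
  ... | plus = refl
  ... | minus = refl

  respectsWord≡allLetters : ∀ {n} (w : Vec Sign n) Z → respectsWord w Z ≡ ∀ᵇ (λ i → letterHolds Z (lookup w i) i)
  respectsWord≡allLetters w Z = ∀ᵇ-cong (respectsWordAt w Z) _ (respectsWordAt≡letterHolds w Z)

  respectsWord-cong : ∀ {n} (w : Vec Sign n) {Z1 Z2} → SameTriples (suc (suc n)) Z1 Z2 → respectsWord w Z1 ≡ respectsWord w Z2
  respectsWord-cong w {Z1} {Z2} h = trans (respectsWord≡allLetters w Z1) (trans (∀ᵇ-cong _ _ (λ i → go (lookup w i) i)) (sym (respectsWord≡allLetters w Z2)))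
    where
    go : ∀ s i → letterHolds Z1 s i ≡ letterHolds Z2 s i
    go plus i = h _ _ _
    go minus i = h _ _ _

  lookup-∷ʳ-inject₁ : ∀ {n} (w : Vec Sign n) s (i : Fin n) → lookup (w ∷ʳ s) (inject₁ i) ≡ lookup w i
  lookup-∷ʳ-inject₁ (x ∷ w) s zero = refl
  lookup-∷ʳ-inject₁ (x ∷ w) s (suc i) = lookup-∷ʳ-inject₁ w s i

  lookup-∷ʳ-fromℕ : ∀ {n} (w : Vec Sign n) s → lookup (w ∷ʳ s) (fromℕ n) ≡ s
  lookup-∷ʳ-fromℕ [] s = refl
  lookup-∷ʳ-fromℕ (x ∷ w) s = lookup-∷ʳ-fromℕ w s

  ∀ᵇ-last : ∀ {n} (p : Fin (suc n) → Bool) → ∀ᵇ p ≡ ∀ᵇ (p ∘ inject₁) ∧ p (fromℕ n)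
  ∀ᵇ-last {n} p = ⇔⇒≡ to from
    where
    to : ∀ᵇ p ≡ true → (∀ᵇ (p ∘ inject₁) ∧ p (fromℕ n)) ≡ true
    to e = ∧-intro (∀ᵇ-intro (p ∘ inject₁) (λ x → ∀ᵇ-elim p e (inject₁ x))) (∀ᵇ-elim p e (fromℕ n))
    from : (∀ᵇ (p ∘ inject₁) ∧ p (fromℕ n)) ≡ true → ∀ᵇ p ≡ true
    from e = ∀ᵇ-intro p go
      where
      go : ∀ x → p x ≡ true
      go x with unlast x in ex
      ... | just y rewrite unlast≡just x ex = ∀ᵇ-elim (p ∘ inject₁) (∧-elimˡ (∀ᵇ (p ∘ inject₁)) e) y
      ... | nothing rewrite unlast≡nothing x ex = ∧-elimʳ (∀ᵇ (p ∘ inject₁)) e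

  lastLetterHolds : ∀ {n} → Triples (suc (suc n)) → Fin (suc (suc n)) → Sign → Bool
  lastLetterHolds {n} Z a plus = newTriple Z a (pt-m-1 n) (pt-m n)
  lastLetterHolds {n} Z a minus = newTriple Z a (pt-m n) (pt-m-1 n)

  respectsWord-∷ʳ-insertAfter : ∀ {n} (w : Vec Sign n) s (Z : Triples (suc (suc n))) a →
    respectsWord (w ∷ʳ s) (insertAfter Z a) ≡ respectsWord w Z ∧ lastLetterHolds Z a s
  respectsWord-∷ʳ-insertAfter {n} w s Z a =
    trans (respectsWord≡allLetters (w ∷ʳ s) (insertAfter Z a))
    (trans (∀ᵇ-last {n} (λ i → letterHolds (insertAfter Z a) (lookup (w ∷ʳ s) i) i))
    (cong₂ _∧_ (trans (∀ᵇ-cong (λ i → letterHolds (insertAfter Z a) (lookup (w ∷ʳ s) (inject₁ i)) (inject₁ i)) (λ i → letterHolds Z (lookup w i) i) old) (sym (respectsWord≡allLetters w Z))) (last s)))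
    where
    old : ∀ i → letterHolds (insertAfter Z a) (lookup (w ∷ʳ s) (inject₁ i)) (inject₁ i) ≡ letterHolds Z (lookup w i) i
    old i rewrite lookup-∷ʳ-inject₁ w s i with lookup w i
    ... | plus = restrict-insertAfter Z a _ _ _
    ... | minus = restrict-insertAfter Z a _ _ _
    last : ∀ s → letterHolds (insertAfter Z a) (lookup (w ∷ʳ s) (fromℕ n)) (fromℕ n) ≡ lastLetterHolds Z a s
    last s rewrite lookup-∷ʳ-fromℕ w s with s
    ... | plus rewrite unlast-inject₁ (pt-m-1 n) | unlast-inject₁ (pt-m n) | unlast-fromℕ (suc (suc n)) = refl
    ... | minus rewrite unlast-inject₁ (pt-m-1 n) | unlast-inject₁ (pt-m n) | unlast-fromℕ (suc (suc n)) = refl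


module InsertionContents where

  open import Defs
  open Booleans
  open Counting
  open Sums
  open CyclicOrder
  open Insertion
  open import Data.Bool using (Bool; true; false; _∧_; not)
  import Data.Bool.Properties as BP
  open import Data.Nat using (ℕ; suc; _+_; _≤_; s≤s; _≡ᵇ_)
  import Data.Nat.Properties as NP
  open import Data.Fin using (Fin; suc; fromℕ; inject₁; _≟_)
  open import Data.List using (allFin)
  open import Data.Product using (_,_)
  open import Data.Sum using (inj₁; inj₂)
  open import Relation.Nullary using (¬_)
  open import Relation.Nullary.Decidable using (⌊_⌋)
  open import Relation.Binary.PropositionalEquality
  open ≡-Reasoning

  module Contents {m : ℕ} {Z : Triples m} (T : IsCyclicOrder Z) (a : Fin m) where
    open Geometry T
    open InsertAfter T a using (newTriple-cases; newTriple-old; newTriple-at)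

    private
      N : Fin (suc m)
      N = fromℕ m
      i : Fin m → Fin (suc m)
      i = inject₁
      E : Triples (suc m)
      E = insertAfter Z a

    newTriple≡arc : ∀ {u v} → ¬ u ≡ v → newTriple Z a v u ≡ arc Z u v a
    newTriple≡arc {u} {v} n = ⇔⇒≡ to from
      where
      to : newTriple Z a v u ≡ true → arc Z u v a ≡ true
      to e with newTriple-cases e
      ... | inj₁ p = ∨-introʳ {⌊ a ≟ u ⌋} (cyc² p)
      ... | inj₂ (p , q) = ∨-introˡ (⌊≟⌋-true (sym p))
      from : arc Z u v a ≡ true → newTriple Z a v u ≡ true
      from e with ∨-elim {⌊ a ≟ u ⌋} e
      ... | inj₁ p = newTriple-at (sym (⌊≟⌋-true⇒≡ p)) (λ q → n (trans (sym (⌊≟⌋-true⇒≡ p)) (sym q)))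
      ... | inj₂ p = newTriple-old (cyc p)

    content-split-last : ∀ u v → content E u v ≡ sumMap (λ x → 𝟙 (E u (i x) v)) (allFin m) + 𝟙 (E u N v)
    content-split-last u v = trans (content≡content′ E u v) (sumMap-allFin-last (λ x → 𝟙 (E u x v)))

    content-old-new : ∀ u → content E (i u) N ≡ position Z u a
    content-old-new u = begin
      content E (i u) N
        ≡⟨ content-split-last (i u) N ⟩
      sumMap (λ x → 𝟙 (E (i u) (i x) N)) (allFin m) + 𝟙 (E (i u) N N)
        ≡⟨ cong₂ _+_ (sumMap-cong (allFin m) old) last ⟩
      sumMap (λ x → 𝟙 (newTriple Z a u x)) (allFin m) + 0
        ≡⟨ NP.+-identityʳ _ ⟩
      sumMap (λ x → 𝟙 (newTriple Z a u x)) (allFin m)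
        ≡⟨ sumMap-cong (allFin m) (λ x → 𝟙-∨-disjoint (Z a u x) _ (λ p q → ≢₁₃ p (sym (⌊≟⌋-true⇒≡ (∧-elimˡ ⌊ x ≟ a ⌋ q))))) ⟩
      sumMap (λ x → 𝟙 (Z a u x) + 𝟙 (⌊ x ≟ a ⌋ ∧ not ⌊ u ≟ a ⌋)) (allFin m)
        ≡⟨ sumMap-+ (λ x → 𝟙 (Z a u x)) (λ x → 𝟙 (⌊ x ≟ a ⌋ ∧ not ⌊ u ≟ a ⌋)) (allFin m) ⟩
      sumMap (λ x → 𝟙 (Z a u x)) (allFin m) + sumMap (λ x → 𝟙 (⌊ x ≟ a ⌋ ∧ not ⌊ u ≟ a ⌋)) (allFin m)
        ≡⟨ cong₂ _+_ (sumMap-cong (allFin m) (λ x → cong 𝟙 (cyc-≡ a u x))) (count-a (not ⌊ u ≟ a ⌋)) ⟩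
      content′ Z u a + 𝟙 (not ⌊ u ≟ a ⌋)
        ≡⟨ cong (λ b → content′ Z u a + 𝟙 (not b)) (⌊≟⌋-sym u a) ⟩
      position Z u a ∎
      where
      old : ∀ x → 𝟙 (E (i u) (i x) N) ≡ 𝟙 (newTriple Z a u x)
      old x rewrite unlast-inject₁ u | unlast-inject₁ x | unlast-fromℕ m = refl
      last : 𝟙 (E (i u) N N) ≡ 0
      last rewrite unlast-inject₁ u | unlast-fromℕ m = refl
      count-a : ∀ b → sumMap (λ x → 𝟙 (⌊ x ≟ a ⌋ ∧ b)) (allFin m) ≡ 𝟙 b
      count-a true = trans (sumMap-cong (allFin m) (λ x → cong 𝟙 (BP.∧-identityʳ ⌊ x ≟ a ⌋))) (count-singleton a)
      count-a false = trans (sumMap-cong (allFin m) (λ x → cong 𝟙 (BP.∧-zeroʳ ⌊ x ≟ a ⌋))) (sumMap-zero (allFin m))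

    content-new-old : ∀ v → ¬ v ≡ a → content E N (i v) ≡ content′ Z a v
    content-new-old v n = trans (content-split-last N (i v)) (trans (cong₂ _+_ (sumMap-cong (allFin m) pt) lastz) (NP.+-identityʳ _))
      where
      pt : ∀ x → 𝟙 (E N (i x) (i v)) ≡ 𝟙 (Z a x v)
      pt x rewrite unlast-inject₁ v | unlast-inject₁ x | unlast-fromℕ m | ⌊≟⌋-false n = cong 𝟙 (BP.∨-identityʳ (Z a x v))
      lastz : 𝟙 (E N N (i v)) ≡ 0
      lastz rewrite unlast-fromℕ m = refl

    content-old-old : ∀ u v → ¬ u ≡ v → content E (i u) (i v) ≡ content′ Z u v + 𝟙 (arc Z u v a)
    content-old-old u v n = trans (content-split-last (i u) (i v)) (cong₂ _+_ (sumMap-cong (allFin m) pt) lastz)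
      where
      pt : ∀ x → 𝟙 (E (i u) (i x) (i v)) ≡ 𝟙 (Z u x v)
      pt x rewrite unlast-inject₁ v | unlast-inject₁ x | unlast-inject₁ u = refl
      lastz : 𝟙 (E (i u) N (i v)) ≡ 𝟙 (arc Z u v a)
      lastz rewrite unlast-inject₁ v | unlast-inject₁ u | unlast-fromℕ m = cong 𝟙 (newTriple≡arc n)

  module ArcSums {m : ℕ} {Z : Triples m} (T : IsCyclicOrder Z) where
    open Geometry T

    count-arc≡sumBelow : ∀ {X Y} (G : ℕ → Bool) (H : Fin m → Bool) → (∀ a → arc Z X Y a ≡ true → H a ≡ G (position Z X a)) →
      count (λ a → arc Z X Y a ∧ H a) (allFin m) ≡ sumBelow (suc (content′ Z X Y)) (λ s → 𝟙 (G s))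
    count-arc≡sumBelow {X} {Y} G H hH =
      trans (sumMap-cong (allFin m) pt)
      (trans (sumMap-sumBelow (suc c) (λ a s → 𝟙 ((arc Z X Y a ∧ (position Z X a ≡ᵇ s)) ∧ G s)) (allFin m))
      (sumBelow-cong (suc c) _ _ (λ s lt → st s (NP.≤-pred lt))))
      where
      c : ℕ
      c = content′ Z X Y
      pt : ∀ a → 𝟙 (arc Z X Y a ∧ H a) ≡ sumBelow (suc c) (λ s → 𝟙 ((arc Z X Y a ∧ (position Z X a ≡ᵇ s)) ∧ G s))
      pt a with arc Z X Y a in ea
      ... | false = sym (sumBelow-zero (suc c))
      ... | true rewrite hH a ea = sym (trans
              (sumBelow-single (suc c) (λ s → (position Z X a ≡ᵇ s) ∧ G s) (position Z X a)
                 (λ s e → sym (≡ᵇ⇒≡ (∧-elimˡ (position Z X a ≡ᵇ s) e))) (s≤s (position≤content′ ea)))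
              (cong (λ b → 𝟙 (b ∧ G (position Z X a))) (≡ᵇ-refl (position Z X a))))
      st : ∀ s → s ≤ c → sumMap (λ a → 𝟙 ((arc Z X Y a ∧ (position Z X a ≡ᵇ s)) ∧ G s)) (allFin m) ≡ 𝟙 (G s)
      st s le with G s
      ... | true = trans (sumMap-cong (allFin m) (λ a → cong 𝟙 (BP.∧-identityʳ _))) (positionCount≡1 s le)
      ... | false = trans (sumMap-cong (allFin m) (λ a → cong 𝟙 (BP.∧-zeroʳ _))) (sumMap-zero (allFin m))


module Reindexing where

  open Booleans
  open Sums
  open import Data.Bool using (true; _∧_)
  open import Data.Nat using (ℕ; suc; _+_; _∸_; _≤_; _<_; s≤s; _≡ᵇ_; _<ᵇ_)
  import Data.Nat.Properties as NP
  open import Data.Product using (_×_; _,_; proj₁; proj₂)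
  open import Relation.Binary.PropositionalEquality

  +1+ : ∀ u v → u + 1 + v ≡ suc (u + v)
  +1+ u v = cong (_+ v) (NP.+-comm u 1)

  +1+-comm : ∀ u v → u + 1 + v ≡ v + 1 + u
  +1+-comm u v = trans (+1+ u v) (trans (cong suc (NP.+-comm u v)) (sym (+1+ v u)))

  +-suc-+1 : ∀ u v → u + suc v ≡ u + 1 + v
  +-suc-+1 u v = trans (NP.+-suc u v) (sym (+1+ u v))

  +1+≡⇒<×∸ : ∀ u v S → u + 1 + v ≡ S → (u < S) × (v ≡ S ∸ 1 ∸ u)
  +1+≡⇒<×∸ u v S e rewrite sym e | +1+ u v = s≤s (NP.m≤m+n u v) , sym (NP.m+n∸m≡n u v)

  <×∸⇒+1+≡ : ∀ u v S → u < S → v ≡ S ∸ 1 ∸ u → u + 1 + v ≡ S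
  <×∸⇒+1+≡ u v (suc S) (s≤s le) e rewrite +1+ u v | e = cong suc (NP.m+[n∸m]≡n le)

  +≡+-≤ˡ⇒≤ʳ : ∀ i j p s → i + j ≡ p + s → i ≤ p → s ≤ j
  +≡+-≤ˡ⇒≤ʳ i j p s e le = NP.+-cancelˡ-≤ i s j (subst (i + s ≤_) (sym e) (NP.+-mono-≤ le (NP.≤-refl {s})))

  +≡+-≤ʳ⇒≤ˡ : ∀ i j p s → i + j ≡ p + s → s ≤ j → i ≤ p
  +≡+-≤ʳ⇒≤ˡ i j p s e le =
    NP.+-cancelˡ-≤ s i p (subst₂ _≤_ (NP.+-comm i s) (trans e (NP.+-comm p s)) (NP.+-mono-≤ (NP.≤-refl {i}) le))

  ≡ᵇ-+ˡ : ∀ t u j → (u ≡ᵇ j) ≡ (t + u ≡ᵇ t + j)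
  ≡ᵇ-+ˡ t u j = ⇔⇒≡ (λ e → ≡⇒≡ᵇ (cong (t +_) (≡ᵇ⇒≡ e))) (λ e → ≡⇒≡ᵇ (NP.+-cancelˡ-≡ t u j (≡ᵇ⇒≡ e)))

  ∧₄-elim : ∀ {p q r s} → (p ∧ q ∧ r ∧ s) ≡ true → p ≡ true × q ≡ true × r ≡ true × s ≡ true
  ∧₄-elim {true} {true} {true} {true} _ = refl , refl , refl , refl

  ∧₄-intro : ∀ {p q r s} → p ≡ true → q ≡ true → r ≡ true → s ≡ true → (p ∧ q ∧ r ∧ s) ≡ true
  ∧₄-intro refl refl refl refl = refl

  ∧₄-≡ : ∀ p q r s {p′ q′ r′ s′} →
         (p ≡ true → q ≡ true → r ≡ true → s ≡ true → (p′ ∧ q′ ∧ r′ ∧ s′) ≡ true) →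
         (p′ ≡ true → q′ ≡ true → r′ ≡ true → s′ ≡ true → (p ∧ q ∧ r ∧ s) ≡ true) →
         (p ∧ q ∧ r ∧ s) ≡ (p′ ∧ q′ ∧ r′ ∧ s′)
  ∧₄-≡ p q r s to from = ⇔⇒≡ (λ e → let (a , b , c , d) = ∧₄-elim e in to a b c d)
                     (λ e → let (a , b , c , d) = ∧₄-elim e in from a b c d)

  -- The side conditions produced by the six nonzero cases, each rewritten into the
  -- form in which the corresponding summand of the recurrences is indexed.
  reindex₁ : ∀ i j k x y z → ((i <ᵇ suc y) ∧ (i ≡ᵇ i) ∧ (y ≡ᵇ i + j) ∧ (z + 1 + x ≡ᵇ k)) ≡
                             ((z <ᵇ k) ∧ (x ≡ᵇ k ∸ 1 ∸ z) ∧ (y ≡ᵇ i + j) ∧ (z ≡ᵇ z))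
  reindex₁ i j k x y z = ∧₄-≡ (i <ᵇ suc y) (i ≡ᵇ i) (y ≡ᵇ i + j) (z + 1 + x ≡ᵇ k)
    (λ _ _ ey eK → let (lt , ex) = +1+≡⇒<×∸ z x k (≡ᵇ⇒≡ eK) in ∧₄-intro (<⇒<ᵇ lt) (≡⇒≡ᵇ ex) ey (≡ᵇ-refl z))
    (λ lt ex ey _ → ∧₄-intro (<⇒<ᵇ (s≤s (subst (i ≤_) (sym (≡ᵇ⇒≡ ey)) (NP.m≤m+n i j)))) (≡ᵇ-refl i) ey
                              (≡⇒≡ᵇ (<×∸⇒+1+≡ z x k (<ᵇ⇒< lt) (≡ᵇ⇒≡ ex))))

  reindex₂ : ∀ i j k p q r → ((i <ᵇ suc p) ∧ (i ≡ᵇ i) ∧ (p + 1 + q ≡ᵇ i + j) ∧ (r ≡ᵇ k)) ≡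
                             ((q <ᵇ j) ∧ (p ≡ᵇ i + j ∸ 1 ∸ q) ∧ (q ≡ᵇ q) ∧ (r ≡ᵇ k))
  reindex₂ i j k p q r = ∧₄-≡ (i <ᵇ suc p) (i ≡ᵇ i) (p + 1 + q ≡ᵇ i + j) (r ≡ᵇ k)
    (λ l _ ee er → ∧₄-intro (<⇒<ᵇ (+≡+-≤ˡ⇒≤ʳ i j p (suc q) (trans (sym (≡ᵇ⇒≡ ee)) (sym (+-suc-+1 p q))) (NP.≤-pred (<ᵇ⇒< l))))
                            (≡⇒≡ᵇ (proj₂ (+1+≡⇒<×∸ q p (i + j) (trans (+1+-comm q p) (≡ᵇ⇒≡ ee))))) (≡ᵇ-refl q) er)
    (λ lt ex _ er →
       let pq≡ij : p + 1 + q ≡ i + j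
           pq≡ij = trans (+1+-comm p q) (<×∸⇒+1+≡ q p (i + j) (NP.≤-trans (<ᵇ⇒< lt) (NP.m≤n+m j i)) (≡ᵇ⇒≡ ex))
       in ∧₄-intro (<⇒<ᵇ (s≤s (+≡+-≤ʳ⇒≤ˡ i j p (suc q) (trans (sym pq≡ij) (sym (+-suc-+1 p q))) (<ᵇ⇒< lt))))
                   (≡ᵇ-refl i) (≡⇒≡ᵇ pq≡ij) er)

  reindex₃ : ∀ i j k x y z → ((k <ᵇ suc z) ∧ (z + 1 + x ≡ᵇ k + i) ∧ (y ≡ᵇ j) ∧ (k ≡ᵇ k)) ≡
                             ((x <ᵇ i) ∧ (x ≡ᵇ x) ∧ (y ≡ᵇ j) ∧ (z ≡ᵇ i + k ∸ 1 ∸ x))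
  reindex₃ i j k x y z = ∧₄-≡ (k <ᵇ suc z) (z + 1 + x ≡ᵇ k + i) (y ≡ᵇ j) (k ≡ᵇ k) {q′ = x ≡ᵇ x}
    (λ l ee ey _ → ∧₄-intro (<⇒<ᵇ (+≡+-≤ˡ⇒≤ʳ k i z (suc x) (trans (sym (≡ᵇ⇒≡ ee)) (sym (+-suc-+1 z x))) (NP.≤-pred (<ᵇ⇒< l))))
                            (≡ᵇ-refl x) ey
                            (≡⇒≡ᵇ (proj₂ (+1+≡⇒<×∸ x z (i + k) (trans (+1+-comm x z) (trans (≡ᵇ⇒≡ ee) (NP.+-comm k i)))))))
    (λ lt _ ey ez →
       let zx≡ki : z + 1 + x ≡ k + i
           zx≡ki = trans (+1+-comm z x) (trans (<×∸⇒+1+≡ x z (i + k) (NP.≤-trans (<ᵇ⇒< lt) (NP.m≤m+n i k)) (≡ᵇ⇒≡ ez)) (NP.+-comm i k))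
       in ∧₄-intro (<⇒<ᵇ (s≤s (+≡+-≤ʳ⇒≤ˡ k i z (suc x) (trans (sym zx≡ki) (sym (+-suc-+1 z x))) (<ᵇ⇒< lt))))
                   (≡⇒≡ᵇ zx≡ki) ey (≡ᵇ-refl k))

  reindex₄ : ∀ i j k p q r → (((i ∸ (p + 1)) <ᵇ suc q) ∧ (p + 1 + (i ∸ (p + 1)) ≡ᵇ i) ∧ (q ≡ᵇ (i ∸ (p + 1)) + j) ∧ (r ≡ᵇ k)) ≡
                             ((p <ᵇ i) ∧ (p ≡ᵇ p) ∧ (q ≡ᵇ i + j ∸ 1 ∸ p) ∧ (r ≡ᵇ k))
  reindex₄ i j k p q r = ∧₄-≡ ((i ∸ (p + 1)) <ᵇ suc q) (p + 1 + (i ∸ (p + 1)) ≡ᵇ i) (q ≡ᵇ (i ∸ (p + 1)) + j) (r ≡ᵇ k) {q′ = p ≡ᵇ p}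
    (λ _ e₁ e₂ er → ∧₄-intro (<⇒<ᵇ (proj₁ (+1+≡⇒<×∸ p t i (≡ᵇ⇒≡ e₁)))) (≡ᵇ-refl p)
       (≡⇒≡ᵇ (proj₂ (+1+≡⇒<×∸ p q (i + j) (trans (cong (p + 1 +_) (≡ᵇ⇒≡ e₂)) (trans (sym (NP.+-assoc (p + 1) t j)) (cong (_+ j) (≡ᵇ⇒≡ e₁)))))))
       er)
    (λ lt _ eq er →
       let pt≡i : p + 1 + t ≡ i
           pt≡i = NP.m+[n∸m]≡n (subst (_≤ i) (NP.+-comm 1 p) (<ᵇ⇒< lt))
           pq≡ij : p + 1 + q ≡ i + j
           pq≡ij = <×∸⇒+1+≡ p q (i + j) (NP.≤-trans (<ᵇ⇒< lt) (NP.m≤m+n i j)) (≡ᵇ⇒≡ eq)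
           q≡tj : q ≡ t + j
           q≡tj = NP.+-cancelˡ-≡ (p + 1) q (t + j) (trans pq≡ij (trans (cong (_+ j) (sym pt≡i)) (NP.+-assoc (p + 1) t j)))
       in ∧₄-intro (<⇒<ᵇ (s≤s (subst (t ≤_) (sym q≡tj) (NP.m≤m+n t j)))) (≡⇒≡ᵇ pt≡i) (≡⇒≡ᵇ q≡tj) er)
    where
    t : ℕ
    t = i ∸ (p + 1)

  reindex₅ : ∀ i j k x y z → (((k ∸ (z + 1)) <ᵇ suc x) ∧ (x ≡ᵇ (k ∸ (z + 1)) + i) ∧ (y ≡ᵇ j) ∧ (z + 1 + (k ∸ (z + 1)) ≡ᵇ k)) ≡
                             ((z <ᵇ k) ∧ (x ≡ᵇ i + k ∸ 1 ∸ z) ∧ (y ≡ᵇ j) ∧ (z ≡ᵇ z))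
  reindex₅ i j k x y z = ∧₄-≡ ((k ∸ (z + 1)) <ᵇ suc x) (x ≡ᵇ (k ∸ (z + 1)) + i) (y ≡ᵇ j) (z + 1 + (k ∸ (z + 1)) ≡ᵇ k)
    (λ _ ex ey e₄ → ∧₄-intro (<⇒<ᵇ (proj₁ (+1+≡⇒<×∸ z t k (≡ᵇ⇒≡ e₄))))
       (≡⇒≡ᵇ (proj₂ (+1+≡⇒<×∸ z x (i + k)
          (trans (cong (z + 1 +_) (≡ᵇ⇒≡ ex)) (trans (sym (NP.+-assoc (z + 1) t i)) (trans (cong (_+ i) (≡ᵇ⇒≡ e₄)) (NP.+-comm k i)))))))
       ey (≡ᵇ-refl z))
    (λ lt ex ey _ →
       let zt≡k : z + 1 + t ≡ k
           zt≡k = NP.m+[n∸m]≡n (subst (_≤ k) (NP.+-comm 1 z) (<ᵇ⇒< lt))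
           zx≡ki : z + 1 + x ≡ k + i
           zx≡ki = trans (<×∸⇒+1+≡ z x (i + k) (NP.≤-trans (<ᵇ⇒< lt) (NP.m≤n+m k i)) (≡ᵇ⇒≡ ex)) (NP.+-comm i k)
           x≡ti : x ≡ t + i
           x≡ti = NP.+-cancelˡ-≡ (z + 1) x (t + i) (trans zx≡ki (trans (cong (_+ i) (sym zt≡k)) (NP.+-assoc (z + 1) t i)))
       in ∧₄-intro (<⇒<ᵇ (s≤s (subst (t ≤_) (sym x≡ti) (NP.m≤m+n t i)))) (≡⇒≡ᵇ x≡ti) ey (≡⇒≡ᵇ zt≡k))
    where
    t : ℕ
    t = k ∸ (z + 1)

  reindex₆ : ∀ i j k p q r → ((k <ᵇ suc r) ∧ (r ≡ᵇ k + i) ∧ (p + 1 + q ≡ᵇ j) ∧ (k ≡ᵇ k)) ≡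
                             ((q <ᵇ j) ∧ (p ≡ᵇ j ∸ 1 ∸ q) ∧ (q ≡ᵇ q) ∧ (r ≡ᵇ i + k))
  reindex₆ i j k p q r = ∧₄-≡ (k <ᵇ suc r) (r ≡ᵇ k + i) (p + 1 + q ≡ᵇ j) (k ≡ᵇ k)
    (λ _ er ej _ → let (lt , ep) = +1+≡⇒<×∸ q p j (trans (+1+-comm q p) (≡ᵇ⇒≡ ej))
                   in ∧₄-intro (<⇒<ᵇ lt) (≡⇒≡ᵇ ep) (≡ᵇ-refl q) (≡⇒≡ᵇ (trans (≡ᵇ⇒≡ {r} {k + i} er) (NP.+-comm k i))))
    (λ lt ep _ er →
       let r≡ki : r ≡ k + i
           r≡ki = trans (≡ᵇ⇒≡ er) (NP.+-comm i k)
       in ∧₄-intro (<⇒<ᵇ (s≤s (subst (k ≤_) (sym r≡ki) (NP.m≤m+n k i)))) (≡⇒≡ᵇ r≡ki)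
                   (≡⇒≡ᵇ (trans (+1+-comm p q) (<×∸⇒+1+≡ q p j (<ᵇ⇒< lt) (≡ᵇ⇒≡ ep)))) (≡ᵇ-refl k))
module Cases where

  open import Defs
  open Booleans
  open Counting
  open Sums
  open import Data.Bool.Properties using (¬-not; not-¬)
  open CyclicOrder
  open Insertion
  open InsertionContents
  open Reindexing
  open WordCondition
  open import Data.Bool using (Bool; true; false; _∧_)
  open import Data.Nat using (ℕ; zero; suc; _+_; _∸_; _≡ᵇ_; _<ᵇ_)
  import Data.Nat.Properties as NP
  open import Data.Fin using (Fin; zero; suc; fromℕ; inject₁; _≟_)
  open import Data.List using (allFin)
  open import Data.Product using (_×_; _,_)
  open import Data.Sum using (_⊎_; inj₁; inj₂)
  open import Data.Empty using (⊥; ⊥-elim)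
  open import Relation.Nullary using (¬_)
  open import Relation.Nullary.Decidable using (⌊_⌋)
  open import Relation.Binary.PropositionalEquality

  -- A, B, C are the points m − 1, m, 1 of [m], m = n + 2, distinct because n ≥ 1;
  -- N is the new point m + 1 and B′ is B viewed in [m + 1].
  module Points (n₀ : ℕ) where
    n : ℕ
    n = suc n₀
    m : ℕ
    m = suc (suc n)
    A : Fin m
    A = pt-m-1 n
    B : Fin m
    B = pt-m n
    C : Fin m
    C = zero
    N : Fin (suc m)
    N = fromℕ m
    B′ : Fin (suc m)
    B′ = inject₁ B

    nAB : ¬ A ≡ B
    nAB = inject₁≢fromℕ (fromℕ n)
    nBC : ¬ B ≡ C
    nBC ()
    nAC : ¬ A ≡ C
    nAC ()

    module Counts (Z : Triples m) (T : IsCyclicOrder Z) where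
      open Geometry T
      module Contentsᵃ (a : Fin m) = Contents T a
      open ArcSums T

      E : Fin m → Triples (suc m)
      E a = insertAfter Z a

      lastLetter-plus : ∀ a → lastLetterHolds Z a plus ≡ arc Z B A a
      lastLetter-plus a = Contentsᵃ.newTriple≡arc a (λ q → nAB (sym q))
      lastLetter-minus : ∀ a → lastLetterHolds Z a minus ≡ arc Z A B a
      lastLetter-minus a = Contentsᵃ.newTriple≡arc a nAB
      Q⁺-arc : ∀ a → E a B′ N zero ≡ arc Z B C a
      Q⁺-arc a = trans (insertAfter-old-new-old Z a B C) (Contentsᵃ.newTriple≡arc a nBC)
      Q⁻-arc : ∀ a → E a zero N B′ ≡ arc Z C B a
      Q⁻-arc a = trans (insertAfter-old-new-old Z a C B) (Contentsᵃ.newTriple≡arc a (λ q → nBC (sym q)))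

      content-BN : ∀ a → content (E a) B′ N ≡ position Z B a
      content-BN a = Contentsᵃ.content-old-new a B
      content-CN : ∀ a → content (E a) zero N ≡ position Z C a
      content-CN a = Contentsᵃ.content-old-new a C
      content-NC : ∀ a → ¬ C ≡ a → content (E a) N zero ≡ content′ Z a C
      content-NC a C≢a = Contentsᵃ.content-new-old a C C≢a
      content-NB : ∀ a → ¬ B ≡ a → content (E a) N B′ ≡ content′ Z a B
      content-NB a B≢a = Contentsᵃ.content-new-old a B B≢a
      content-CB : ∀ a → content (E a) zero B′ ≡ content′ Z C B + 𝟙 (arc Z C B a)
      content-CB a = Contentsᵃ.content-old-old a C B (λ q → nBC (sym q))
      content-BC : ∀ a → content (E a) B′ zero ≡ content′ Z B C + 𝟙 (arc Z B C a)
      content-BC a = Contentsᵃ.content-old-old a B C nBC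

      orientation : (Z A B C ≡ true × Z C B A ≡ false) ⊎ (Z C B A ≡ true × Z A B C ≡ false)
      orientation with total {A} {B} {C} nAB nBC nAC
      ... | inj₁ h = inj₁ (h , asym h)
      ... | inj₂ h = inj₂ (h , asym h)

      mc⁺ : ℕ → ℕ → ℕ → Fin m → Bool
      mc⁺ i j k a = mcEq (E a) B′ N zero i j k

      -- In each case the new letter and the condition defining Q± confine a to one arc of Z,
      -- and the multi-content of the new order depends on a only through its position there.
      -- So the count collapses to one indicator (L), as does the right-hand side (R), and the
      -- two indicators agree after reindexing (F).
      count-plus-Q⁺-ABC : ∀ i j k → Z A B C ≡ true → Z C B A ≡ false →
        count (λ a → (lastLetterHolds Z a plus ∧ E a B′ N zero) ∧ mc⁺ i j k a) (allFin m) ≡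
          sumBelow j (λ j' → 𝟙 (Z C B A ∧ mcEq Z B A C (i + j ∸ 1 ∸ j') j' k)) +
          sumBelow k (λ k' → 𝟙 (Z A B C ∧ mcEq Z A B C (k ∸ 1 ∸ k') (i + j) k'))
      count-plus-Q⁺-ABC i j k h h′ = trans L (trans F (sym R))
        where
        y : ℕ
        y = content′ Z B C
        G : ℕ → Bool
        G t = (t ≡ᵇ i) ∧ ((y ≡ᵇ t + j) ∧ (content′ Z C B ≡ᵇ k))
        mc-via-position : ∀ a → arc Z B C a ≡ true → mc⁺ i j k a ≡ G (position Z B a)
        mc-via-position a e = cong₂ _∧_ (cong (_≡ᵇ i) (content-BN a)) (cong₂ _∧_ e2 e3)
          where
          e2 : (content (E a) N zero ≡ᵇ j) ≡ (y ≡ᵇ position Z B a + j)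
          e2 = trans (cong (_≡ᵇ j) (content-NC a (arc-end-≢ nBC e))) (trans (≡ᵇ-+ˡ (position Z B a) (content′ Z a C) j) (cong (_≡ᵇ position Z B a + j) (position+content′ e)))
          e3 : (content (E a) zero B′ ≡ᵇ k) ≡ (content′ Z C B ≡ᵇ k)
          e3 = cong (_≡ᵇ k) (trans (content-CB a) (trans (cong (λ b → content′ Z C B + 𝟙 b) (arc-reverse-false nBC e)) (NP.+-identityʳ _)))
        L : count (λ a → (lastLetterHolds Z a plus ∧ E a B′ N zero) ∧ mc⁺ i j k a) (allFin m) ≡ 𝟙 ((i <ᵇ suc y) ∧ G i)
        L = trans (sumMap-cong (allFin m) (λ a → cong (λ b → 𝟙 (b ∧ mc⁺ i j k a)) (trans (cong₂ _∧_ (lastLetter-plus a) (Q⁺-arc a)) (arc-∧-subarc {a = a} (cyc h)))))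
             (trans (count-arc≡sumBelow G (mc⁺ i j k) mc-via-position) (sumBelow-support₁ (suc y) G i (λ s e → ≡ᵇ⇒≡ (∧-elimˡ (s ≡ᵇ i) e))))
        G' : ℕ → Bool
        G' k' = mcEq Z A B C (k ∸ 1 ∸ k') (i + j) k'
        R : sumBelow j (λ j' → 𝟙 (Z C B A ∧ mcEq Z B A C (i + j ∸ 1 ∸ j') j' k)) +
            sumBelow k (λ k' → 𝟙 (Z A B C ∧ mcEq Z A B C (k ∸ 1 ∸ k') (i + j) k')) ≡ 0 + 𝟙 ((content Z C A <ᵇ k) ∧ G' (content Z C A))
        R = cong₂ _+_ (sumBelow-false-∧ h′ j _) (trans (sumBelow-true-∧ h k _) (sumBelow-support₁ k G' (content Z C A)
              (λ s e → sym (≡ᵇ⇒≡ (∧-elimʳ (content Z B C ≡ᵇ i + j) (∧-elimʳ (content Z A B ≡ᵇ k ∸ 1 ∸ s) e))))))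
        F : 𝟙 ((i <ᵇ suc y) ∧ G i) ≡ 0 + 𝟙 ((content Z C A <ᵇ k) ∧ G' (content Z C A))
        F rewrite content≡content′ Z C A | content≡content′ Z A B | content≡content′ Z B C | content′-additive (cyc² h) = cong 𝟙 (reindex₁ i j k (content′ Z A B) (content′ Z B C) (content′ Z C A))

      count-plus-Q⁺-CBA : ∀ i j k → Z C B A ≡ true → Z A B C ≡ false →
        count (λ a → (lastLetterHolds Z a plus ∧ E a B′ N zero) ∧ mc⁺ i j k a) (allFin m) ≡
          sumBelow j (λ j' → 𝟙 (Z C B A ∧ mcEq Z B A C (i + j ∸ 1 ∸ j') j' k)) +
          sumBelow k (λ k' → 𝟙 (Z A B C ∧ mcEq Z A B C (k ∸ 1 ∸ k') (i + j) k'))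
      count-plus-Q⁺-CBA i j k h h′ = trans L (trans F (sym R))
        where
        p : ℕ
        p = content′ Z B A
        G : ℕ → Bool
        G t = (t ≡ᵇ i) ∧ ((content′ Z B C ≡ᵇ t + j) ∧ (content′ Z C B ≡ᵇ k))
        mc-via-position : ∀ a → arc Z B A a ≡ true → mc⁺ i j k a ≡ G (position Z B a)
        mc-via-position a e = cong₂ _∧_ (cong (_≡ᵇ i) (content-BN a)) (cong₂ _∧_ e2 e3)
          where
          eBC : arc Z B C a ≡ true
          eBC = arc-extendʳ (cyc h) e
          e2 : (content (E a) N zero ≡ᵇ j) ≡ (content′ Z B C ≡ᵇ position Z B a + j)
          e2 = trans (cong (_≡ᵇ j) (content-NC a (arc-end-≢ nBC eBC))) (trans (≡ᵇ-+ˡ (position Z B a) (content′ Z a C) j) (cong (_≡ᵇ position Z B a + j) (position+content′ (arc-extendʳ (cyc h) e))))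
          e3 : (content (E a) zero B′ ≡ᵇ k) ≡ (content′ Z C B ≡ᵇ k)
          e3 = cong (_≡ᵇ k) (trans (content-CB a) (trans (cong (λ b → content′ Z C B + 𝟙 b) (arc-reverse-false nBC eBC)) (NP.+-identityʳ _)))
        L : count (λ a → (lastLetterHolds Z a plus ∧ E a B′ N zero) ∧ mc⁺ i j k a) (allFin m) ≡ 𝟙 ((i <ᵇ suc p) ∧ G i)
        L = trans (sumMap-cong (allFin m) (λ a → cong (λ b → 𝟙 (b ∧ mc⁺ i j k a)) (trans (cong₂ _∧_ (lastLetter-plus a) (Q⁺-arc a)) (arc-∧-subarc′ {a = a} (cyc h)))))
             (trans (count-arc≡sumBelow G (mc⁺ i j k) mc-via-position) (sumBelow-support₁ (suc p) G i (λ s e → ≡ᵇ⇒≡ (∧-elimˡ (s ≡ᵇ i) e))))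
        G' : ℕ → Bool
        G' j' = mcEq Z B A C (i + j ∸ 1 ∸ j') j' k
        R : sumBelow j (λ j' → 𝟙 (Z C B A ∧ mcEq Z B A C (i + j ∸ 1 ∸ j') j' k)) +
            sumBelow k (λ k' → 𝟙 (Z A B C ∧ mcEq Z A B C (k ∸ 1 ∸ k') (i + j) k')) ≡ 𝟙 ((content Z A C <ᵇ j) ∧ G' (content Z A C)) + 0
        R = cong₂ _+_ (trans (sumBelow-true-∧ h j _) (sumBelow-support₁ j G' (content Z A C)
              (λ s e → sym (≡ᵇ⇒≡ (∧-elimˡ (content Z A C ≡ᵇ s) (∧-elimʳ (content Z B A ≡ᵇ i + j ∸ 1 ∸ s) e)))))) (sumBelow-false-∧ h′ k _)
        F : 𝟙 ((i <ᵇ suc p) ∧ G i) ≡ 𝟙 ((content Z A C <ᵇ j) ∧ G' (content Z A C)) + 0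
        F rewrite content≡content′ Z A C | content≡content′ Z B A | content≡content′ Z C B | content′-additive (cyc h) =
          trans (cong 𝟙 (reindex₂ i j k (content′ Z B A) (content′ Z A C) (content′ Z C B))) (sym (NP.+-identityʳ _))

      count-plus-Q⁺ : ∀ i j k → count (λ a → (lastLetterHolds Z a plus ∧ E a B′ N zero) ∧ mc⁺ i j k a) (allFin m) ≡
        sumBelow j (λ j' → 𝟙 (Z C B A ∧ mcEq Z B A C (i + j ∸ 1 ∸ j') j' k)) +
        sumBelow k (λ k' → 𝟙 (Z A B C ∧ mcEq Z A B C (k ∸ 1 ∸ k') (i + j) k'))
      count-plus-Q⁺ i j k with orientation
      ... | inj₁ (h , h′) = count-plus-Q⁺-ABC i j k h h′
      ... | inj₂ (h , h′) = count-plus-Q⁺-CBA i j k h h′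

      mc⁻ : ℕ → ℕ → ℕ → Fin m → Bool
      mc⁻ i j k a = mcEq (E a) N B′ zero i j k

      nCB : ¬ C ≡ B
      nCB q = nBC (sym q)
      nCA : ¬ C ≡ A
      nCA q = nAC (sym q)

      count-plus-Q⁻-ABC : ∀ i j k → Z A B C ≡ true → Z C B A ≡ false →
        count (λ a → (lastLetterHolds Z a plus ∧ E a zero N B′) ∧ mc⁻ i j k a) (allFin m) ≡
          sumBelow i (λ i' → 𝟙 (Z A B C ∧ mcEq Z A B C i' j (i + k ∸ 1 ∸ i')))
      count-plus-Q⁻-ABC i j k h h′ = trans L (trans F (sym R))
        where
        z : ℕ
        z = content′ Z C A
        cond : ∀ a → (arc Z B A a ∧ arc Z C B a) ≡ arc Z C A a
        cond a = ⇔⇒≡ to (λ e → ∧-intro (arc-extendˡ (cyc h) e) (arc-extendʳ (cyc² h) e))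
          where
          to : (arc Z B A a ∧ arc Z C B a) ≡ true → arc Z C A a ≡ true
          to e with arc-split-cases (cyc h) (∧-elimˡ (arc Z B A a) e)
          ... | inj₂ p = p
          ... | inj₁ p = ⊥-elim (not-¬ (∧-elimʳ (arc Z B A a) e) (arc-reverse-false nBC p))
        G : ℕ → Bool
        G t = (content′ Z C B ≡ᵇ t + i) ∧ ((content′ Z B C ≡ᵇ j) ∧ (t ≡ᵇ k))
        mc-via-position : ∀ a → arc Z C A a ≡ true → mc⁻ i j k a ≡ G (position Z C a)
        mc-via-position a e = cong₂ _∧_ e1 (cong₂ _∧_ e2 (cong (_≡ᵇ k) (content-CN a)))
          where
          eCB : arc Z C B a ≡ true
          eCB = arc-extendʳ (cyc² h) e
          e1 : (content (E a) N B′ ≡ᵇ i) ≡ (content′ Z C B ≡ᵇ position Z C a + i)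
          e1 = trans (cong (_≡ᵇ i) (content-NB a (arc-end-≢ nCB eCB))) (trans (≡ᵇ-+ˡ (position Z C a) (content′ Z a B) i) (cong (_≡ᵇ position Z C a + i) (position+content′ (arc-extendʳ (cyc² h) e))))
          e2 : (content (E a) B′ zero ≡ᵇ j) ≡ (content′ Z B C ≡ᵇ j)
          e2 = cong (_≡ᵇ j) (trans (content-BC a) (trans (cong (λ b → content′ Z B C + 𝟙 b) (arc-reverse-false nCB eCB)) (NP.+-identityʳ _)))
        L : count (λ a → (lastLetterHolds Z a plus ∧ E a zero N B′) ∧ mc⁻ i j k a) (allFin m) ≡ 𝟙 ((k <ᵇ suc z) ∧ G k)
        L = trans (sumMap-cong (allFin m) (λ a → cong (λ b → 𝟙 (b ∧ mc⁻ i j k a)) (trans (cong₂ _∧_ (lastLetter-plus a) (Q⁻-arc a)) (cond a))))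
             (trans (count-arc≡sumBelow G (mc⁻ i j k) mc-via-position) (sumBelow-support₁ (suc z) G k (λ s e → ≡ᵇ⇒≡ (∧-elimʳ (content′ Z B C ≡ᵇ j) (∧-elimʳ (content′ Z C B ≡ᵇ s + i) e)))))
        G' : ℕ → Bool
        G' i' = mcEq Z A B C i' j (i + k ∸ 1 ∸ i')
        R : sumBelow i (λ i' → 𝟙 (Z A B C ∧ mcEq Z A B C i' j (i + k ∸ 1 ∸ i'))) ≡ 𝟙 ((content Z A B <ᵇ i) ∧ G' (content Z A B))
        R = trans (sumBelow-true-∧ h i _) (sumBelow-support₁ i G' (content Z A B) (λ s e → sym (≡ᵇ⇒≡ (∧-elimˡ (content Z A B ≡ᵇ s) e))))
        F : 𝟙 ((k <ᵇ suc z) ∧ G k) ≡ 𝟙 ((content Z A B <ᵇ i) ∧ G' (content Z A B))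
        F rewrite content≡content′ Z A B | content≡content′ Z B C | content≡content′ Z C A | content′-additive (cyc² h) = cong 𝟙 (reindex₃ i j k (content′ Z A B) (content′ Z B C) (content′ Z C A))

      count-plus-Q⁻-CBA : ∀ i j k → Z C B A ≡ true → Z A B C ≡ false →
        count (λ a → (lastLetterHolds Z a plus ∧ E a zero N B′) ∧ mc⁻ i j k a) (allFin m) ≡
          sumBelow i (λ i' → 𝟙 (Z A B C ∧ mcEq Z A B C i' j (i + k ∸ 1 ∸ i')))
      count-plus-Q⁻-CBA i j k h h′ = trans (count-none _ (allFin m) (λ a → ¬-not (λ e → go a (∧-elimˡ (lastLetterHolds Z a plus ∧ E a zero N B′) e))))
                                 (sym (sumBelow-false-∧ h′ i _))
        where
        go : ∀ a → (lastLetterHolds Z a plus ∧ E a zero N B′) ≡ true → ⊥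
        go a e = arc-disjoint h a (subst (_≡ true) (Q⁻-arc a) (∧-elimʳ (lastLetterHolds Z a plus) e)) (subst (_≡ true) (lastLetter-plus a) (∧-elimˡ (lastLetterHolds Z a plus) e))


      count-plus-Q⁻ : ∀ i j k → count (λ a → (lastLetterHolds Z a plus ∧ E a zero N B′) ∧ mc⁻ i j k a) (allFin m) ≡
        sumBelow i (λ i' → 𝟙 (Z A B C ∧ mcEq Z A B C i' j (i + k ∸ 1 ∸ i')))
      count-plus-Q⁻ i j k with orientation
      ... | inj₁ (h , h′) = count-plus-Q⁻-ABC i j k h h′
      ... | inj₂ (h , h′) = count-plus-Q⁻-CBA i j k h h′
      count-minus-Q⁺-ABC : ∀ i j k → Z A B C ≡ true → Z C B A ≡ false →
        count (λ a → (lastLetterHolds Z a minus ∧ E a B′ N zero) ∧ mc⁺ i j k a) (allFin m) ≡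
          sumBelow i (λ i' → 𝟙 (Z C B A ∧ mcEq Z B A C i' (i + j ∸ 1 ∸ i') k))
      count-minus-Q⁺-ABC i j k h h′ = trans (count-none _ (allFin m) (λ a → ¬-not (λ e → go a (∧-elimˡ (lastLetterHolds Z a minus ∧ E a B′ N zero) e))))
                                 (sym (sumBelow-false-∧ h′ i _))
        where
        go : ∀ a → (lastLetterHolds Z a minus ∧ E a B′ N zero) ≡ true → ⊥
        go a e = arc-disjoint h a (subst (_≡ true) (lastLetter-minus a) (∧-elimˡ (lastLetterHolds Z a minus) e)) (subst (_≡ true) (Q⁺-arc a) (∧-elimʳ (lastLetterHolds Z a minus) e))

      count-minus-Q⁺-CBA : ∀ i j k → Z C B A ≡ true → Z A B C ≡ false →
        count (λ a → (lastLetterHolds Z a minus ∧ E a B′ N zero) ∧ mc⁺ i j k a) (allFin m) ≡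
          sumBelow i (λ i' → 𝟙 (Z C B A ∧ mcEq Z B A C i' (i + j ∸ 1 ∸ i') k))
      count-minus-Q⁺-CBA i j k h h′ = trans L (trans F (sym R))
        where
        q : ℕ
        q = content′ Z A C
        p : ℕ
        p = content′ Z B A
        t0 : ℕ
        t0 = i ∸ (p + 1)
        cond : ∀ a → (arc Z A B a ∧ arc Z B C a) ≡ arc Z A C a
        cond a = ⇔⇒≡ to (λ e → ∧-intro (arc-extendʳ (cyc² h) e) (arc-extendˡ (cyc h) e))
          where
          to : (arc Z A B a ∧ arc Z B C a) ≡ true → arc Z A C a ≡ true
          to e with arc-split-cases (cyc² h) (∧-elimˡ (arc Z A B a) e)
          ... | inj₁ pp = pp
          ... | inj₂ pp = ⊥-elim (not-¬ (∧-elimʳ (arc Z A B a) e) (arc-reverse-false nCB pp))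
        G : ℕ → Bool
        G t = (p + 1 + t ≡ᵇ i) ∧ ((q ≡ᵇ t + j) ∧ (content′ Z C B ≡ᵇ k))
        mc-via-position : ∀ a → arc Z A C a ≡ true → mc⁺ i j k a ≡ G (position Z A a)
        mc-via-position a e = cong₂ _∧_ e1 (cong₂ _∧_ e2 e3)
          where
          eAB : arc Z A B a ≡ true
          eAB = arc-extendʳ (cyc² h) e
          eBC : arc Z B C a ≡ true
          eBC = arc-extendˡ (cyc h) e
          ttB : position Z B a ≡ p + 1 + position Z A a
          ttB = trans (position-≢ (arc-≢end nAB eAB)) (trans (NP.+-comm 1 (content′ Z B a)) (content′-position (cyc h) e))
          e1 : (content (E a) B′ N ≡ᵇ i) ≡ (p + 1 + position Z A a ≡ᵇ i)
          e1 = cong (_≡ᵇ i) (trans (content-BN a) ttB)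
          e2 : (content (E a) N zero ≡ᵇ j) ≡ (q ≡ᵇ position Z A a + j)
          e2 = trans (cong (_≡ᵇ j) (content-NC a (arc-end-≢ nBC eBC))) (trans (≡ᵇ-+ˡ (position Z A a) (content′ Z a C) j) (cong (_≡ᵇ position Z A a + j) (position+content′ e)))
          e3 : (content (E a) zero B′ ≡ᵇ k) ≡ (content′ Z C B ≡ᵇ k)
          e3 = cong (_≡ᵇ k) (trans (content-CB a) (trans (cong (λ b → content′ Z C B + 𝟙 b) (arc-reverse-false nBC eBC)) (NP.+-identityʳ _)))
        L : count (λ a → (lastLetterHolds Z a minus ∧ E a B′ N zero) ∧ mc⁺ i j k a) (allFin m) ≡ 𝟙 ((t0 <ᵇ suc q) ∧ G t0)
        L = trans (sumMap-cong (allFin m) (λ a → cong (λ b → 𝟙 (b ∧ mc⁺ i j k a)) (trans (cong₂ _∧_ (lastLetter-minus a) (Q⁺-arc a)) (cond a))))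
             (trans (count-arc≡sumBelow G (mc⁺ i j k) mc-via-position) (sumBelow-support₁ (suc q) G t0 (λ s e →
                trans (sym (NP.m+n∸m≡n (p + 1) s)) (cong (_∸ (p + 1)) (≡ᵇ⇒≡ (∧-elimˡ (p + 1 + s ≡ᵇ i) e))))))
        G' : ℕ → Bool
        G' i' = mcEq Z B A C i' (i + j ∸ 1 ∸ i') k
        R : sumBelow i (λ i' → 𝟙 (Z C B A ∧ mcEq Z B A C i' (i + j ∸ 1 ∸ i') k)) ≡ 𝟙 ((content Z B A <ᵇ i) ∧ G' (content Z B A))
        R = trans (sumBelow-true-∧ h i _) (sumBelow-support₁ i G' (content Z B A) (λ s e → sym (≡ᵇ⇒≡ (∧-elimˡ (content Z B A ≡ᵇ s) e))))
        F : 𝟙 ((t0 <ᵇ suc q) ∧ G t0) ≡ 𝟙 ((content Z B A <ᵇ i) ∧ G' (content Z B A))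
        F rewrite content≡content′ Z B A | content≡content′ Z A C | content≡content′ Z C B = cong 𝟙 (reindex₄ i j k (content′ Z B A) (content′ Z A C) (content′ Z C B))


      count-minus-Q⁺ : ∀ i j k → count (λ a → (lastLetterHolds Z a minus ∧ E a B′ N zero) ∧ mc⁺ i j k a) (allFin m) ≡
        sumBelow i (λ i' → 𝟙 (Z C B A ∧ mcEq Z B A C i' (i + j ∸ 1 ∸ i') k))
      count-minus-Q⁺ i j k with orientation
      ... | inj₁ (h , h′) = count-minus-Q⁺-ABC i j k h h′
      ... | inj₂ (h , h′) = count-minus-Q⁺-CBA i j k h h′
      count-minus-Q⁻-ABC : ∀ i j k → Z A B C ≡ true → Z C B A ≡ false →
        count (λ a → (lastLetterHolds Z a minus ∧ E a zero N B′) ∧ mc⁻ i j k a) (allFin m) ≡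
          sumBelow k (λ k' → 𝟙 (Z A B C ∧ mcEq Z A B C (i + k ∸ 1 ∸ k') j k')) +
          sumBelow j (λ j' → 𝟙 (Z C B A ∧ mcEq Z B A C (j ∸ 1 ∸ j') j' (i + k)))
      count-minus-Q⁻-ABC i j k h h′ = trans L (trans F (sym R))
        where
        x : ℕ
        x = content′ Z A B
        z : ℕ
        z = content′ Z C A
        t0 : ℕ
        t0 = k ∸ (z + 1)
        cond : ∀ a → (arc Z A B a ∧ arc Z C B a) ≡ arc Z A B a
        cond a = ⇔⇒≡ (∧-elimˡ (arc Z A B a)) (λ e → ∧-intro e (arc-extendˡ (cyc² h) e))
        G : ℕ → Bool
        G t = (x ≡ᵇ t + i) ∧ ((content′ Z B C ≡ᵇ j) ∧ (z + 1 + t ≡ᵇ k))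
        mc-via-position : ∀ a → arc Z A B a ≡ true → mc⁻ i j k a ≡ G (position Z A a)
        mc-via-position a e = cong₂ _∧_ e1 (cong₂ _∧_ e2 e3)
          where
          nBCa : arc Z B C a ≡ false
          nBCa = ¬-not (λ f → arc-disjoint h a e f)
          aC : ¬ a ≡ C
          aC q with ∨-elim {⌊ a ≟ A ⌋} e
          ... | inj₁ pp = nCA (trans (sym q) (⌊≟⌋-true⇒≡ pp))
          ... | inj₂ pp = asym-⊥ h (cyc (subst (λ c → Z A c B ≡ true) q pp))
          e1 : (content (E a) N B′ ≡ᵇ i) ≡ (x ≡ᵇ position Z A a + i)
          e1 = trans (cong (_≡ᵇ i) (content-NB a (arc-end-≢ nAB e))) (trans (≡ᵇ-+ˡ (position Z A a) (content′ Z a B) i) (cong (_≡ᵇ position Z A a + i) (position+content′ e)))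
          e2 : (content (E a) B′ zero ≡ᵇ j) ≡ (content′ Z B C ≡ᵇ j)
          e2 = cong (_≡ᵇ j) (trans (content-BC a) (trans (cong (λ b → content′ Z B C + 𝟙 b) nBCa) (NP.+-identityʳ _)))
          e3 : (content (E a) zero N ≡ᵇ k) ≡ (z + 1 + position Z A a ≡ᵇ k)
          e3 = cong (_≡ᵇ k) (trans (content-CN a) (trans (position-≢ aC) (trans (NP.+-comm 1 (content′ Z C a)) (content′-position (cyc² h) e))))
        L : count (λ a → (lastLetterHolds Z a minus ∧ E a zero N B′) ∧ mc⁻ i j k a) (allFin m) ≡ 𝟙 ((t0 <ᵇ suc x) ∧ G t0)
        L = trans (sumMap-cong (allFin m) (λ a → cong (λ b → 𝟙 (b ∧ mc⁻ i j k a)) (trans (cong₂ _∧_ (lastLetter-minus a) (Q⁻-arc a)) (cond a))))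
             (trans (count-arc≡sumBelow G (mc⁻ i j k) mc-via-position) (sumBelow-support₁ (suc x) G t0 (λ s e →
                trans (sym (NP.m+n∸m≡n (z + 1) s)) (cong (_∸ (z + 1)) (≡ᵇ⇒≡ (∧-elimʳ (content′ Z B C ≡ᵇ j) (∧-elimʳ (x ≡ᵇ s + i) e)))))))
        G' : ℕ → Bool
        G' k' = mcEq Z A B C (i + k ∸ 1 ∸ k') j k'
        R : sumBelow k (λ k' → 𝟙 (Z A B C ∧ mcEq Z A B C (i + k ∸ 1 ∸ k') j k')) +
            sumBelow j (λ j' → 𝟙 (Z C B A ∧ mcEq Z B A C (j ∸ 1 ∸ j') j' (i + k))) ≡ 𝟙 ((content Z C A <ᵇ k) ∧ G' (content Z C A)) + 0
        R = cong₂ _+_ (trans (sumBelow-true-∧ h k _) (sumBelow-support₁ k G' (content Z C A)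
              (λ s e → sym (≡ᵇ⇒≡ (∧-elimʳ (content Z B C ≡ᵇ j) (∧-elimʳ (content Z A B ≡ᵇ i + k ∸ 1 ∸ s) e)))))) (sumBelow-false-∧ h′ j _)
        F : 𝟙 ((t0 <ᵇ suc x) ∧ G t0) ≡ 𝟙 ((content Z C A <ᵇ k) ∧ G' (content Z C A)) + 0
        F rewrite content≡content′ Z A B | content≡content′ Z B C | content≡content′ Z C A = trans (cong 𝟙 (reindex₅ i j k (content′ Z A B) (content′ Z B C) (content′ Z C A))) (sym (NP.+-identityʳ _))

      count-minus-Q⁻-CBA : ∀ i j k → Z C B A ≡ true → Z A B C ≡ false →
        count (λ a → (lastLetterHolds Z a minus ∧ E a zero N B′) ∧ mc⁻ i j k a) (allFin m) ≡
          sumBelow k (λ k' → 𝟙 (Z A B C ∧ mcEq Z A B C (i + k ∸ 1 ∸ k') j k')) +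
          sumBelow j (λ j' → 𝟙 (Z C B A ∧ mcEq Z B A C (j ∸ 1 ∸ j') j' (i + k)))
      count-minus-Q⁻-CBA i j k h h′ = trans L (trans F (sym R))
        where
        r : ℕ
        r = content′ Z C B
        cond : ∀ a → (arc Z A B a ∧ arc Z C B a) ≡ arc Z C B a
        cond a = ⇔⇒≡ (∧-elimʳ (arc Z A B a)) (λ e → ∧-intro (arc-extendˡ (cyc² h) e) e)
        G : ℕ → Bool
        G t = (r ≡ᵇ t + i) ∧ ((content′ Z B C ≡ᵇ j) ∧ (t ≡ᵇ k))
        mc-via-position : ∀ a → arc Z C B a ≡ true → mc⁻ i j k a ≡ G (position Z C a)
        mc-via-position a e = cong₂ _∧_ e1 (cong₂ _∧_ e2 (cong (_≡ᵇ k) (content-CN a)))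
          where
          e1 : (content (E a) N B′ ≡ᵇ i) ≡ (r ≡ᵇ position Z C a + i)
          e1 = trans (cong (_≡ᵇ i) (content-NB a (arc-end-≢ nCB e))) (trans (≡ᵇ-+ˡ (position Z C a) (content′ Z a B) i) (cong (_≡ᵇ position Z C a + i) (position+content′ e)))
          e2 : (content (E a) B′ zero ≡ᵇ j) ≡ (content′ Z B C ≡ᵇ j)
          e2 = cong (_≡ᵇ j) (trans (content-BC a) (trans (cong (λ b → content′ Z B C + 𝟙 b) (arc-reverse-false nCB e)) (NP.+-identityʳ _)))
        L : count (λ a → (lastLetterHolds Z a minus ∧ E a zero N B′) ∧ mc⁻ i j k a) (allFin m) ≡ 𝟙 ((k <ᵇ suc r) ∧ G k)
        L = trans (sumMap-cong (allFin m) (λ a → cong (λ b → 𝟙 (b ∧ mc⁻ i j k a)) (trans (cong₂ _∧_ (lastLetter-minus a) (Q⁻-arc a)) (cond a))))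
             (trans (count-arc≡sumBelow G (mc⁻ i j k) mc-via-position) (sumBelow-support₁ (suc r) G k (λ s e → ≡ᵇ⇒≡ (∧-elimʳ (content′ Z B C ≡ᵇ j) (∧-elimʳ (r ≡ᵇ s + i) e)))))
        G' : ℕ → Bool
        G' j' = mcEq Z B A C (j ∸ 1 ∸ j') j' (i + k)
        R : sumBelow k (λ k' → 𝟙 (Z A B C ∧ mcEq Z A B C (i + k ∸ 1 ∸ k') j k')) +
            sumBelow j (λ j' → 𝟙 (Z C B A ∧ mcEq Z B A C (j ∸ 1 ∸ j') j' (i + k))) ≡ 0 + 𝟙 ((content Z A C <ᵇ j) ∧ G' (content Z A C))
        R = cong₂ _+_ (sumBelow-false-∧ h′ k _) (trans (sumBelow-true-∧ h j _) (sumBelow-support₁ j G' (content Z A C)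
              (λ s e → sym (≡ᵇ⇒≡ (∧-elimˡ (content Z A C ≡ᵇ s) (∧-elimʳ (content Z B A ≡ᵇ j ∸ 1 ∸ s) e))))))
        F : 𝟙 ((k <ᵇ suc r) ∧ G k) ≡ 0 + 𝟙 ((content Z A C <ᵇ j) ∧ G' (content Z A C))
        F rewrite content≡content′ Z B A | content≡content′ Z A C | content≡content′ Z C B | content′-additive (cyc h) = cong 𝟙 (reindex₆ i j k (content′ Z B A) (content′ Z A C) (content′ Z C B))



      count-minus-Q⁻ : ∀ i j k → count (λ a → (lastLetterHolds Z a minus ∧ E a zero N B′) ∧ mc⁻ i j k a) (allFin m) ≡
        sumBelow k (λ k' → 𝟙 (Z A B C ∧ mcEq Z A B C (i + k ∸ 1 ∸ k') j k')) +
        sumBelow j (λ j' → 𝟙 (Z C B A ∧ mcEq Z B A C (j ∸ 1 ∸ j') j' (i + k)))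
      count-minus-Q⁻ i j k with orientation
      ... | inj₁ (h , h′) = count-minus-Q⁻-ABC i j k h h′
      ... | inj₂ (h , h′) = count-minus-Q⁻-CBA i j k h h′
module Recurrences where

  open import Defs
  open Booleans
  open Counting
  open Sums
  open CyclicOrder
  open Insertion
  open Decomposition
  open WordCondition
  open Cases
  open import Data.Bool using (Bool; true; false; _∧_; not)
  import Data.Bool.Properties as BP
  open import Data.Nat using (ℕ; zero; suc; _+_; _∸_; _≥_; z≤n; s≤s; _≡ᵇ_)
  open import Data.Fin using (Fin; zero; suc)
  open import Data.List using (allFin)
  open import Data.Vec using (Vec; _∷ʳ_)
  open import Data.Product using (_×_; _,_)
  open import Relation.Binary.PropositionalEquality
  open ≡-Reasoning
  open import Function using (_∘_)

  ∧-reassoc₄ : ∀ a b c d → (((a ∧ b) ∧ c) ∧ d) ≡ (a ∧ ((b ∧ c) ∧ d))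
  ∧-reassoc₄ true b c d = refl
  ∧-reassoc₄ false b c d = refl

  ∧-reassoc₅ : ∀ a b c d e → (a ∧ (((b ∧ c) ∧ d) ∧ e)) ≡ ((a ∧ b) ∧ ((c ∧ d) ∧ e))
  ∧-reassoc₅ true true c d e = refl
  ∧-reassoc₅ true false c d e = refl
  ∧-reassoc₅ false b c d e = refl

  count-guarded₁ : ∀ {m} (g : Bool) (X : Fin m → Bool) (Y : ℕ → Bool) (b : ℕ) →
    (g ≡ true → count X (allFin m) ≡ sumBelow b (𝟙 ∘ Y)) →
    count (λ a → g ∧ X a) (allFin m) ≡ sumBelow b (λ s → 𝟙 (g ∧ Y s))
  count-guarded₁ true X Y b h = h refl
  count-guarded₁ {m} false X Y b h = trans (sumMap-zero (allFin m)) (sym (sumBelow-zero b))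

  count-guarded₂ : ∀ {m} (g : Bool) (X : Fin m → Bool) (Y₁ Y₂ : ℕ → Bool) (b₁ b₂ : ℕ) →
    (g ≡ true → count X (allFin m) ≡ sumBelow b₁ (𝟙 ∘ Y₁) + sumBelow b₂ (𝟙 ∘ Y₂)) →
    count (λ a → g ∧ X a) (allFin m) ≡ sumBelow b₁ (λ s → 𝟙 (g ∧ Y₁ s)) + sumBelow b₂ (λ s → 𝟙 (g ∧ Y₂ s))
  count-guarded₂ true X Y₁ Y₂ b₁ b₂ h = h refl
  count-guarded₂ {m} false X Y₁ Y₂ b₁ b₂ h = trans (sumMap-zero (allFin m)) (sym (cong₂ _+_ (sumBelow-zero b₁) (sumBelow-zero b₂)))

  sumMap-sumBelow-countWhere : ∀ {m} b (Y : ℕ → Triples m → Bool) →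
    sumMap (λ Z → sumBelow b (λ s → 𝟙 (Y s Z))) (allTriples m) ≡ sumBelow b (λ s → countWhere (Y s))
  sumMap-sumBelow-countWhere {m} b Y =
    trans (sumMap-sumBelow b (λ Z s → 𝟙 (Y s Z)) (allTriples m))
          (sumBelow-cong b _ _ (λ s _ → sym (length-filter≡count (Y s) (allTriples m))))

  content-cong : ∀ {m} {Z₁ Z₂ : Triples m} → SameTriples m Z₁ Z₂ → ∀ u v → content Z₁ u v ≡ content Z₂ u v
  content-cong {m} {Z₁} {Z₂} h u v =
    trans (content≡content′ Z₁ u v) (trans (sumMap-cong (allFin m) (λ x → cong 𝟙 (h u x v))) (sym (content≡content′ Z₂ u v)))

  mcEq-cong : ∀ {m} {Z₁ Z₂ : Triples m} → SameTriples m Z₁ Z₂ → ∀ u v x i j k → mcEq Z₁ u v x i j k ≡ mcEq Z₂ u v x i j k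
  mcEq-cong h u v x i j k =
    cong₂ _∧_ (cong (_≡ᵇ i) (content-cong h u v)) (cong₂ _∧_ (cong (_≡ᵇ j) (content-cong h v x)) (cong (_≡ᵇ k) (content-cong h x u)))

  module ForWord (n₀ : ℕ) (w : Vec Sign (suc n₀)) where
    open Points n₀

    Q⁺ : Triples (suc m) → Bool
    Q⁺ Z = Z B′ N zero

    Q⁻ : Triples (suc m) → Bool
    Q⁻ Z = Z zero N B′

    MC⁺ : ℕ → ℕ → ℕ → Triples (suc m) → Bool
    MC⁺ i j k Z = mcEq Z B′ N zero i j k

    MC⁻ : ℕ → ℕ → ℕ → Triples (suc m) → Bool
    MC⁻ i j k Z = mcEq Z N B′ zero i j k

    newConditions : Sign → (Triples (suc m) → Bool) → (Triples (suc m) → Bool) → Triples m → Fin m → Bool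
    newConditions s Q MC Z a = (lastLetterHolds Z a s ∧ Q (insertAfter Z a)) ∧ MC (insertAfter Z a)

    order : ∀ Z → inP w Z ≡ true → IsCyclicOrder Z
    order Z e = isTotalCyclicOrder⇒IsCyclicOrder Z (∧-elimˡ (isTotalCyclicOrder Z) e)

    count-over-insertions : ∀ s (Q MC : Triples (suc m) → Bool) →
      (∀ {Z₁ Z₂} → SameTriples (suc m) Z₁ Z₂ → Q Z₁ ≡ Q Z₂) → (∀ {Z₁ Z₂} → SameTriples (suc m) Z₁ Z₂ → MC Z₁ ≡ MC Z₂) →
      countWhere (λ Z → (inP (w ∷ʳ s) Z ∧ Q Z) ∧ MC Z) ≡
      sumMap (λ Z → count (λ a → inP w Z ∧ newConditions s Q MC Z a) (allFin m)) (allTriples m)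
    count-over-insertions s Q MC Q-cong MC-cong = begin
      countWhere (λ Z → (inP (w ∷ʳ s) Z ∧ Q Z) ∧ MC Z)
        ≡⟨ length-filter≡count _ (allTriples (suc m)) ⟩
      count (λ Z → (inP (w ∷ʳ s) Z ∧ Q Z) ∧ MC Z) (allTriples (suc m))
        ≡⟨ sumMap-cong (allTriples (suc m)) (λ Z → cong 𝟙 (∧-reassoc₄ (isTotalCyclicOrder Z) (respectsWord (w ∷ʳ s) Z) (Q Z) (MC Z))) ⟩
      count (λ Z → isTotalCyclicOrder Z ∧ conditions Z) (allTriples (suc m))
        ≡⟨ count-insertions (suc n) conditions (λ h → cong₂ _∧_ (cong₂ _∧_ (respectsWord-cong (w ∷ʳ s) h) (Q-cong h)) (MC-cong h)) ⟩
      sumMap (λ Z → count (λ a → isTotalCyclicOrder Z ∧ conditions (insertAfter Z a)) (allFin m)) (allTriples m)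
        ≡⟨ sumMap-cong (allTriples m) (λ Z → sumMap-cong (allFin m) (λ a → cong 𝟙 (split-word Z a))) ⟩
      sumMap (λ Z → count (λ a → inP w Z ∧ newConditions s Q MC Z a) (allFin m)) (allTriples m) ∎
      where
      conditions : Triples (suc m) → Bool
      conditions Z = (respectsWord (w ∷ʳ s) Z ∧ Q Z) ∧ MC Z
      split-word : ∀ Z a → (isTotalCyclicOrder Z ∧ conditions (insertAfter Z a)) ≡ (inP w Z ∧ newConditions s Q MC Z a)
      split-word Z a =
        trans (cong (λ b → isTotalCyclicOrder Z ∧ ((b ∧ Q (insertAfter Z a)) ∧ MC (insertAfter Z a))) (respectsWord-∷ʳ-insertAfter w s Z a))
              (∧-reassoc₅ (isTotalCyclicOrder Z) (respectsWord w Z) (lastLetterHolds Z a s) (Q (insertAfter Z a)) (MC (insertAfter Z a)))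

    inQ⁺-∧ : ∀ Z X → (inQ⁺ w Z ∧ X) ≡ (inP w Z ∧ (Z A B C ∧ X))
    inQ⁺-∧ Z X = BP.∧-assoc (inP w Z) (Z A B C) X

    inQ⁻-∧ : ∀ Z X → (inQ⁻ w Z ∧ X) ≡ (inP w Z ∧ (Z C B A ∧ X))
    inQ⁻-∧ Z X = BP.∧-assoc (inP w Z) (Z C B A) X

    f⁺-plus : ∀ i j k → f⁺ (w ∷ʳ plus) i j k ≡
             sumBelow j (λ j' → f⁻ w (i + j ∸ 1 ∸ j') j' k)
             + sumBelow k (λ k' → f⁺ w (k ∸ 1 ∸ k') (i + j) k')
    f⁺-plus i j k =
      trans (count-over-insertions plus Q⁺ (MC⁺ i j k) (λ h → h _ _ _) (λ h → mcEq-cong h _ _ _ i j k))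
      (trans (sumMap-cong (allTriples m) per-order)
      (trans (sumMap-+ _ _ (allTriples m))
             (cong₂ _+_ (sumMap-sumBelow-countWhere j (λ j' Z → inQ⁻ w Z ∧ mcEq Z B A C (i + j ∸ 1 ∸ j') j' k))
                        (sumMap-sumBelow-countWhere k (λ k' Z → inQ⁺ w Z ∧ mcEq Z A B C (k ∸ 1 ∸ k') (i + j) k')))))
      where
      per-order : ∀ Z → count (λ a → inP w Z ∧ newConditions plus Q⁺ (MC⁺ i j k) Z a) (allFin m) ≡
                  sumBelow j (λ j' → 𝟙 (inQ⁻ w Z ∧ mcEq Z B A C (i + j ∸ 1 ∸ j') j' k)) +
                  sumBelow k (λ k' → 𝟙 (inQ⁺ w Z ∧ mcEq Z A B C (k ∸ 1 ∸ k') (i + j) k'))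
      per-order Z =
        trans (count-guarded₂ (inP w Z) (newConditions plus Q⁺ (MC⁺ i j k) Z)
                 (λ j' → Z C B A ∧ mcEq Z B A C (i + j ∸ 1 ∸ j') j' k) (λ k' → Z A B C ∧ mcEq Z A B C (k ∸ 1 ∸ k') (i + j) k') j k
                 (λ e → Counts.count-plus-Q⁺ Z (order Z e) i j k))
              (sym (cong₂ _+_ (sumBelow-cong j _ _ (λ s _ → cong 𝟙 (inQ⁻-∧ Z _))) (sumBelow-cong k _ _ (λ s _ → cong 𝟙 (inQ⁺-∧ Z _)))))

    f⁻-plus : ∀ i j k → f⁻ (w ∷ʳ plus) i j k ≡ sumBelow i (λ i' → f⁺ w i' j (i + k ∸ 1 ∸ i'))
    f⁻-plus i j k =
      trans (count-over-insertions plus Q⁻ (MC⁻ i j k) (λ h → h _ _ _) (λ h → mcEq-cong h _ _ _ i j k))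
      (trans (sumMap-cong (allTriples m) per-order)
             (sumMap-sumBelow-countWhere i (λ i' Z → inQ⁺ w Z ∧ mcEq Z A B C i' j (i + k ∸ 1 ∸ i'))))
      where
      per-order : ∀ Z → count (λ a → inP w Z ∧ newConditions plus Q⁻ (MC⁻ i j k) Z a) (allFin m) ≡
                  sumBelow i (λ i' → 𝟙 (inQ⁺ w Z ∧ mcEq Z A B C i' j (i + k ∸ 1 ∸ i')))
      per-order Z =
        trans (count-guarded₁ (inP w Z) (newConditions plus Q⁻ (MC⁻ i j k) Z)
                 (λ i' → Z A B C ∧ mcEq Z A B C i' j (i + k ∸ 1 ∸ i')) i
                 (λ e → Counts.count-plus-Q⁻ Z (order Z e) i j k))
              (sym (sumBelow-cong i _ _ (λ s _ → cong 𝟙 (inQ⁺-∧ Z _))))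

    f⁺-minus : ∀ i j k → f⁺ (w ∷ʳ minus) i j k ≡ sumBelow i (λ i' → f⁻ w i' (i + j ∸ 1 ∸ i') k)
    f⁺-minus i j k =
      trans (count-over-insertions minus Q⁺ (MC⁺ i j k) (λ h → h _ _ _) (λ h → mcEq-cong h _ _ _ i j k))
      (trans (sumMap-cong (allTriples m) per-order)
             (sumMap-sumBelow-countWhere i (λ i' Z → inQ⁻ w Z ∧ mcEq Z B A C i' (i + j ∸ 1 ∸ i') k)))
      where
      per-order : ∀ Z → count (λ a → inP w Z ∧ newConditions minus Q⁺ (MC⁺ i j k) Z a) (allFin m) ≡
                  sumBelow i (λ i' → 𝟙 (inQ⁻ w Z ∧ mcEq Z B A C i' (i + j ∸ 1 ∸ i') k))
      per-order Z =
        trans (count-guarded₁ (inP w Z) (newConditions minus Q⁺ (MC⁺ i j k) Z)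
                 (λ i' → Z C B A ∧ mcEq Z B A C i' (i + j ∸ 1 ∸ i') k) i
                 (λ e → Counts.count-minus-Q⁺ Z (order Z e) i j k))
              (sym (sumBelow-cong i _ _ (λ s _ → cong 𝟙 (inQ⁻-∧ Z _))))

    f⁻-minus : ∀ i j k → f⁻ (w ∷ʳ minus) i j k ≡
             sumBelow k (λ k' → f⁺ w (i + k ∸ 1 ∸ k') j k')
             + sumBelow j (λ j' → f⁻ w (j ∸ 1 ∸ j') j' (i + k))
    f⁻-minus i j k =
      trans (count-over-insertions minus Q⁻ (MC⁻ i j k) (λ h → h _ _ _) (λ h → mcEq-cong h _ _ _ i j k))
      (trans (sumMap-cong (allTriples m) per-order)
      (trans (sumMap-+ _ _ (allTriples m))
             (cong₂ _+_ (sumMap-sumBelow-countWhere k (λ k' Z → inQ⁺ w Z ∧ mcEq Z A B C (i + k ∸ 1 ∸ k') j k'))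
                        (sumMap-sumBelow-countWhere j (λ j' Z → inQ⁻ w Z ∧ mcEq Z B A C (j ∸ 1 ∸ j') j' (i + k))))))
      where
      per-order : ∀ Z → count (λ a → inP w Z ∧ newConditions minus Q⁻ (MC⁻ i j k) Z a) (allFin m) ≡
                  sumBelow k (λ k' → 𝟙 (inQ⁺ w Z ∧ mcEq Z A B C (i + k ∸ 1 ∸ k') j k')) +
                  sumBelow j (λ j' → 𝟙 (inQ⁻ w Z ∧ mcEq Z B A C (j ∸ 1 ∸ j') j' (i + k)))
      per-order Z =
        trans (count-guarded₂ (inP w Z) (newConditions minus Q⁻ (MC⁻ i j k) Z)
                 (λ k' → Z A B C ∧ mcEq Z A B C (i + k ∸ 1 ∸ k') j k') (λ j' → Z C B A ∧ mcEq Z B A C (j ∸ 1 ∸ j') j' (i + k)) k j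
                 (λ e → Counts.count-minus-Q⁻ Z (order Z e) i j k))
              (sym (cong₂ _+_ (sumBelow-cong k _ _ (λ s _ → cong 𝟙 (inQ⁺-∧ Z _))) (sumBelow-cong j _ _ (λ s _ → cong 𝟙 (inQ⁻-∧ Z _)))))


theorem2 : (n : ℕ) → n ≥ 1 → (w : Vec Sign n) → (i j k : ℕ) → i + j + k ≡ n →
    (f⁺ (w ∷ʳ plus) i j k
    ≡ sumBelow j (λ j' → f⁻ w (i + j ∸ 1 ∸ j') j' k)
    + sumBelow k (λ k' → f⁺ w (k ∸ 1 ∸ k') (i + j) k'))
    × (f⁻ (w ∷ʳ plus) i j k
    ≡ sumBelow i (λ i' → f⁺ w i' j (i + k ∸ 1 ∸ i')))
    × (f⁺ (w ∷ʳ minus) i j k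
    ≡ sumBelow i (λ i' → f⁻ w i' (i + j ∸ 1 ∸ i') k))
    × (f⁻ (w ∷ʳ minus) i j k
    ≡ sumBelow k (λ k' → f⁺ w (i + k ∸ 1 ∸ k') j k')
    + sumBelow j (λ j' → f⁻ w (j ∸ 1 ∸ j') j' (i + k)))
-- The recurrences hold for all i, j, k.
theorem2 (suc n₀) (s≤s z≤n) w i j k _ = f⁺-plus i j k , f⁻-plus i j k , f⁺-minus i j k , f⁻-minus i j k
  where open Recurrences.ForWord n₀ w
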